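{- Let $r\geq 2$ be an integer and $G$ a bipartite graph. (i) If $G$ is $(3,3r)$-biregular, then $r+1\leq \check s(G)\leq r^2+1$. (ii) If $G$ is $(3r-3,3r)$-biregular, then $\check s(G)\leq r^2+1$.
   Context: A graph is $(a,b)$-biregular if it is bipartite with a bipartition $(X,Y)$ such that every vertex of $X$ has degree $a$ and every vertex of $Y$ has degree $b$. For a proper edge coloring $\varphi$ of a graph $G$, the palette of a vertex $v$ is the set of colors on edges incident with $v$. The palette index $\check s(G)$ is the minimum number of distinct palettes over all proper edge colorings of $G$. -}

module Defs where

open import Data.Nat using (ℕ; zero; suc; _+_; _*_; _≤_; _<_)
open import Data.Bool using (Bool; true; false; _∧_; T)
import Data.Bool.Properties as BoolP
open import Data.Fin using (Fin)
import Data.Fin.Properties as FinP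
open import Data.Fin.Subset using (Subset)
open import Data.Vec using (tabulate)
import Data.Vec.Properties as VecP
open import Data.List using (List; length; filter; deduplicate; map)
open import Data.List.Base using (allFin)
open import Data.Product using (Σ; ∃; _×_; _,_)
open import Relation.Nullary using (¬_)
open import Relation.Nullary.Decidable using (⌊_⌋)
open import Relation.Binary.PropositionalEquality using (_≡_; _≢_)
open import Data.Fin.Properties using (any?)

record Graph : Set where
  field
    n     : ℕ
    adj   : Fin n → Fin n → Bool
    sym   : ∀ u v → adj u v ≡ adj v u
    irrefl : ∀ v → adj v v ≡ false
open Graph public

degree : (G : Graph) → Fin (n G) → ℕ
degree G v = length (filter (λ u → T? (adj G v u)) (allFin (n G)))
  where open import Data.Bool using (T?)

Biregular : ℕ → ℕ → Graph → Set
Biregular a b G =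
  Σ (Fin (n G) → Bool) λ side →
      (∀ u v → adj G u v ≡ true → side u ≢ side v)
    × (∀ v → side v ≡ false → degree G v ≡ a)
    × (∀ v → side v ≡ true  → degree G v ≡ b)

-- An edge colouring with colours from Fin m: a colour for each ordered pair,
-- required to be symmetric on edges (so it is a colouring of the edges).
record EdgeColouring (G : Graph) (m : ℕ) : Set where
  field
    col    : Fin (n G) → Fin (n G) → Fin m
    colSym : ∀ u v → adj G u v ≡ true → col u v ≡ col v u
open EdgeColouring public

Proper : {G : Graph} {m : ℕ} → EdgeColouring G m → Set
Proper {G} φ = ∀ u v w → adj G u v ≡ true → adj G u w ≡ true → v ≢ w →
               col φ u v ≢ col φ u w

palette : {G : Graph} {m : ℕ} → EdgeColouring G m → Fin (n G) → Subset m
palette {G} φ v = tabulate λ c →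
  ⌊ any? (λ u → T? (adj G v u ∧ ⌊ col φ v u FinP.≟ c ⌋)) ⌋
  where open import Data.Bool using (T?)

numPalettes : {G : Graph} {m : ℕ} → EdgeColouring G m → ℕ
numPalettes {G} φ =
  length (deduplicate (VecP.≡-dec BoolP._≟_) (map (palette φ) (allFin (n G))))

-- š(G) ≤ k : some proper edge colouring has at most k distinct palettes
PaletteIndex≤ : Graph → ℕ → Set
PaletteIndex≤ G k = Σ ℕ λ m → Σ (EdgeColouring G m) λ φ → Proper φ × numPalettes φ ≤ k

-- k ≤ š(G) : every proper edge colouring has at least k distinct palettes
PaletteIndex≥ : Graph → ℕ → Set
PaletteIndex≥ G k = ∀ m (φ : EdgeColouring G m) → Proper φ → k ≤ numPalettes φ

module Submission where

-- Write the degrees as (3s, 3r) with r = s + t, where s = 1 in (i) and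
-- t = 1 in (ii).  König's edge-colouring theorem for bipartite multigraphs (proved by
-- deleting an edge and recolouring a subgraph of maximum degree 2, which is 2-coloured
-- by contracting adjacent edges) is applied twice: first to give every edge a class in
-- Fin 3 such that each triple of edges at a vertex sees every class, then, after adding
-- t dummy edges at each x ∈ X, to give every edge a label in Fin r.  Colouring an edge by
-- (label, class) is proper; every vertex of Y sees all 3r colours, and the palette of
-- x ∈ X is determined by two labels, so at most r² + 1 palettes occur.
--
-- Lower bound.  The 3r colours at y ∈ Y lie in the palettes of its neighbours, which
-- have 3 colours each and so differ from the palette of y; at least r more palettes occur.

open import Defs hiding (sym)
open import Data.Nat as ℕ using (ℕ; zero; suc; _+_; _*_; _∸_; _≤_; _<_; z≤n; s≤s)
import Data.Nat.Properties as ℕP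
open import Data.Fin as F using (Fin; zero; suc; cast; splitAt; join; punchOut; combine; remQuot; _↑ˡ_; _↑ʳ_)
open import Data.Fin.Properties
  using (_≟_; any?; all?; injective⇒≤; punchOut-injective; cast-involutive; join-splitAt; splitAt-join;
         splitAt-↑ˡ; splitAt-↑ʳ; ↑ˡ-injective; ↑ʳ-injective; combine-injective; remQuot-combine; combine-remQuot)
open import Data.Bool using (Bool; true; false; T; T?; not)
import Data.Bool.Properties as BoolP
open import Data.Product using (Σ; ∃; _×_; _,_; proj₁; proj₂)
open import Data.Sum using (_⊎_; inj₁; inj₂; [_,_]′; map₂; swap)
open import Data.Sum.Properties using (inj₁-injective; inj₂-injective)
open import Data.Empty using (⊥; ⊥-elim)
open import Data.Unit using (tt)
open import Data.Vec using (Vec; lookup; tabulate)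
import Data.Vec.Properties as VecP
open import Data.List as List using (List; _∷_; length; filter; allFin; deduplicate)
import Data.List.Properties as ListP
open import Data.List.Relation.Unary.Any using (here; there; index)
open import Data.List.Relation.Unary.Any.Properties using (lookup-index)
import Data.List.Relation.Unary.All as All
open import Data.List.Relation.Unary.AllPairs using ([]; _∷_)
open import Data.List.Relation.Unary.Unique.Propositional using (Unique)
open import Data.List.Relation.Unary.Unique.Propositional.Properties using (filter⁺; allFin⁺)
open import Data.List.Relation.Unary.Unique.DecPropositional.Properties using (deduplicate-!)
open import Data.List.Membership.Propositional using (_∈_)
open import Data.List.Membership.Propositional.Properties
  using (∈-lookup; ∈-filter⁺; ∈-filter⁻; ∈-allFin; ∈-tabulate⁺; ∈-map⁺; ∈-map⁻; ∈-deduplicate⁺; ∈-deduplicate⁻)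
open import Function.Definitions using (Injective)
open import Function.Bundles using (module Equivalence)
open Equivalence using (to; from)
open import Relation.Nullary using (¬_; Dec; yes; no)
open import Relation.Nullary.Decidable
  using (⌊_⌋; _×-dec_; _⊎-dec_; ¬?; toWitness; fromWitness; toWitnessFalse; fromWitnessFalse)
open import Relation.Binary.PropositionalEquality

Inj : {A B : Set} → (A → B) → Set
Inj = Injective _≡_ _≡_

choice : ∀ {A : Set} {P : A → Set} → A → Dec (∃ P) → A
choice _ (yes (a , _)) = a
choice a (no _) = a

choice-spec : ∀ {A : Set} {P : A → Set} (a : A) (dec : Dec (∃ P)) → ∃ P → P (choice a dec)
choice-spec _ (yes (_ , p)) _ = p
choice-spec _ (no none) h = ⊥-elim (none h)

module Counting where

  -- An injection Fin n → Fin r that misses a value z forces n < r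
  -- (compose with `punchOut`, which removes z from the codomain).
  missing⇒< : ∀ {n r} (h : Fin n → Fin r) (z : Fin r) → Inj h → (∀ k → h k ≢ z) → n < r
  missing⇒< {r = suc r} h z h-inj h≢z =
    s≤s (injective⇒≤ (λ eq → h-inj (punchOut-injective (z≢h _) (z≢h _) eq)))
    where
    z≢h : ∀ k → z ≢ h k
    z≢h k eq = h≢z k (sym eq)

  jointly-onto : ∀ {r a b} (f : Fin a → Fin r) (g : Fin b → Fin r) → Inj f → Inj g →
    (∀ i j → f i ≢ g j) → r ≤ a + b → ∀ z → (∃ λ i → f i ≡ z) ⊎ (∃ λ j → g j ≡ z)
  jointly-onto {r} {a} {b} f g f-inj g-inj disjoint r≤a+b z
    with any? (λ i → f i ≟ z) | any? (λ j → g j ≟ z)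
  ... | yes hit | _ = inj₁ hit
  ... | no _ | yes hit = inj₂ hit
  ... | no f-misses | no g-misses =
    ⊥-elim (ℕP.<-irrefl refl (ℕP.≤-<-trans r≤a+b (missing⇒< h z h-inj h-misses)))
    where
    h : Fin (a + b) → Fin r
    h k = [ f , g ]′ (splitAt a k)
    h-misses : ∀ k → h k ≢ z
    h-misses k with splitAt a k
    ... | inj₁ i = λ eq → f-misses (i , eq)
    ... | inj₂ j = λ eq → g-misses (j , eq)
    copair-inj : ∀ u v → [ f , g ]′ u ≡ [ f , g ]′ v → u ≡ v
    copair-inj (inj₁ i) (inj₁ i') eq = cong inj₁ (f-inj eq)
    copair-inj (inj₁ i) (inj₂ j) eq = ⊥-elim (disjoint i j eq)
    copair-inj (inj₂ j) (inj₁ i) eq = ⊥-elim (disjoint i j (sym eq))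
    copair-inj (inj₂ j) (inj₂ j') eq = cong inj₂ (g-inj eq)
    h-inj : Inj h
    h-inj {k} {k'} eq = begin
      k                          ≡⟨ join-splitAt a b k ⟨
      join a b (splitAt a k)     ≡⟨ cong (join a b) (copair-inj (splitAt a k) (splitAt a k') eq) ⟩
      join a b (splitAt a k')    ≡⟨ join-splitAt a b k' ⟩
      k'                         ∎
      where open ≡-Reasoning

  missed-value : ∀ {a r} (f : Fin a → Fin r) → Inj f → a < r → ∃ λ z → ∀ i → f i ≢ z
  missed-value {a} {r} f f-inj a<r with any? (λ z → all? (λ i → ¬? (f i ≟ z)))
  ... | yes missed = missed
  ... | no none = ⊥-elim (ℕP.<⇒≱ a<r (injective⇒≤ preimage-inj))
    where
    hit : ∀ z → ∃ λ i → f i ≡ z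
    hit z with any? (λ i → f i ≟ z)
    ... | yes h = h
    ... | no nh = ⊥-elim (none (z , λ i eq → nh (i , eq)))
    preimage-inj : Inj (λ z → proj₁ (hit z))
    preimage-inj {z} {z'} eq =
      trans (sym (proj₂ (hit z))) (trans (cong f eq) (proj₂ (hit z')))

  injection-onto : ∀ {a r} (f : Fin a → Fin r) → Inj f → r ≤ a → ∀ z → ∃ λ i → f i ≡ z
  injection-onto {a} f f-inj r≤a z
    with jointly-onto f (λ ()) f-inj (λ { {()} }) (λ _ ()) (subst (_ ≤_) (sym (ℕP.+-identityʳ a)) r≤a) z
  ... | inj₁ hit = hit
  ... | inj₂ (() , _)

  avoiding-pairs-bound : ∀ {M l k} (z : Fin (suc l)) (F : Fin M → Fin (suc l) × Fin k) → Inj F →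
    (∀ p → z ≢ proj₁ (F p)) → M ≤ l * k
  avoiding-pairs-bound {M} {l} {k} z F F-inj avoids = injective⇒≤ {f = code} code-inj
    where
    code : Fin M → Fin (l * k)
    code p = combine (punchOut (avoids p)) (proj₂ (F p))
    code-inj : Inj code
    code-inj {p} {p'} eq =
      let parts = combine-injective (punchOut (avoids p)) (proj₂ (F p)) (punchOut (avoids p')) (proj₂ (F p')) eq
      in F-inj (cong₂ _,_ (punchOut-injective (avoids p) (avoids p') (proj₁ parts)) (proj₂ parts))

  -- the case k = 3 used for the lower bound: 3r ≤ 3(L − 1), that is r + 1 ≤ L
  avoiding-triples-bound : ∀ {L} r (z : Fin L) (F : Fin (3 * r) → Fin L × Fin 3) → Inj F →
    (∀ p → z ≢ proj₁ (F p)) → r + 1 ≤ L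
  avoiding-triples-bound {suc l} r z F F-inj avoids = begin
    r + 1   ≡⟨ ℕP.+-comm r 1 ⟩
    suc r   ≤⟨ s≤s (ℕP.*-cancelʳ-≤ r l 3 (subst (_≤ l * 3) (ℕP.*-comm 3 r) (avoiding-pairs-bound z F F-inj avoids))) ⟩
    suc l   ∎
    where open ℕP.≤-Reasoning

  lookup-injective : ∀ {A : Set} {xs : List A} → Unique xs → Inj (List.lookup xs)
  lookup-injective {xs = x ∷ xs} (x∉ ∷ _) {zero} {zero} _ = refl
  lookup-injective {xs = x ∷ xs} (x∉ ∷ _) {zero} {suc j} eq = ⊥-elim (All.lookup x∉ (∈-lookup j) eq)
  lookup-injective {xs = x ∷ xs} (x∉ ∷ _) {suc i} {zero} eq = ⊥-elim (All.lookup x∉ (∈-lookup i) (sym eq))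
  lookup-injective {xs = x ∷ xs} (_ ∷ uniq) {suc i} {suc j} eq = cong suc (lookup-injective uniq eq)

  unique-length-≤ : ∀ {A : Set} {xs ys : List A} → Unique xs → (∀ {z} → z ∈ xs → z ∈ ys) → length xs ≤ length ys
  unique-length-≤ {xs = xs} {ys} uniq xs⊆ys = injective⇒≤ {f = position} position-inj
    where
    position : Fin (length xs) → Fin (length ys)
    position i = index (xs⊆ys (∈-lookup i))
    position-inj : Inj position
    position-inj {i} {j} eq = lookup-injective uniq (begin
      List.lookup xs i                         ≡⟨ lookup-index (xs⊆ys (∈-lookup i)) ⟩
      List.lookup ys (position i)              ≡⟨ cong (List.lookup ys) eq ⟩
      List.lookup ys (position j)              ≡⟨ lookup-index (xs⊆ys (∈-lookup j)) ⟨
      List.lookup xs j                         ∎)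
      where open ≡-Reasoning

-- A bipartite multigraph is described by a finite set of edge slots Fin m,
-- a left endpoint L : Fin m → Fin p, a right endpoint R : Fin m → Fin q, and
-- the set A : EdgeSet m of slots that are actually edges.  Keeping the slots
-- fixed and shrinking A is what makes the inductions below simple.
module Multigraphs where

  EdgeSet : ℕ → Set
  EdgeSet m = Fin m → Bool

  _⊑_ : ∀ {m} → EdgeSet m → EdgeSet m → Set
  A ⊑ B = ∀ e → T (A e) → T (B e)

  indicator : Bool → ℕ
  indicator true = 1
  indicator false = 0

  indicator-mono : ∀ {a b} → (T a → T b) → indicator a ≤ indicator b
  indicator-mono {false} _ = z≤n
  indicator-mono {true} {true} _ = ℕP.≤-refl
  indicator-mono {true} {false} a⇒b = ⊥-elim (a⇒b tt)

  indicator-< : ∀ {a b} → ¬ T a → T b → indicator a < indicator b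
  indicator-< {false} {true} _ _ = s≤s z≤n
  indicator-< {true} ¬a _ = ⊥-elim (¬a tt)

  size : ∀ {m} → EdgeSet m → ℕ
  size {zero} A = 0
  size {suc m} A = indicator (A zero) + size (λ i → A (suc i))

  size-mono : ∀ {m} (A B : EdgeSet m) → A ⊑ B → size A ≤ size B
  size-mono {zero} _ _ _ = z≤n
  size-mono {suc m} A B A⊑B =
    ℕP.+-mono-≤ (indicator-mono (A⊑B zero)) (size-mono _ _ (λ e → A⊑B (suc e)))

  size-< : ∀ {m} (A B : EdgeSet m) e → A ⊑ B → ¬ T (A e) → T (B e) → size A < size B
  size-< A B zero A⊑B ¬a b =
    ℕP.+-mono-<-≤ (indicator-< ¬a b) (size-mono _ _ (λ e → A⊑B (suc e)))
  size-< A B (suc e) A⊑B ¬a b =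
    ℕP.+-mono-≤-< (indicator-mono (A⊑B zero)) (size-< _ _ e (λ e → A⊑B (suc e)) ¬a b)

  delete : ∀ {m} → EdgeSet m → Fin m → EdgeSet m
  delete A e₀ e with e ≟ e₀
  ... | yes _ = false
  ... | no _ = A e

  delete-⊑ : ∀ {m} (A : EdgeSet m) e₀ → delete A e₀ ⊑ A
  delete-⊑ A e₀ e t with e ≟ e₀
  ... | no _ = t

  delete-≢ : ∀ {m} (A : EdgeSet m) e₀ e → T (delete A e₀ e) → e ≢ e₀
  delete-≢ A e₀ e t with e ≟ e₀
  ... | no e≢e₀ = e≢e₀

  delete-keeps : ∀ {m} (A : EdgeSet m) e₀ e → e ≢ e₀ → T (A e) → T (delete A e₀ e)
  delete-keeps A e₀ e e≢e₀ t with e ≟ e₀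
  ... | yes e≡e₀ = e≢e₀ e≡e₀
  ... | no _ = t

  delete-removes : ∀ {m} (A : EdgeSet m) e₀ → ¬ T (delete A e₀ e₀)
  delete-removes A e₀ t = delete-≢ A e₀ e₀ t refl

  delete-< : ∀ {m} (A : EdgeSet m) e₀ → T (A e₀) → size (delete A e₀) < size A
  delete-< A e₀ a₀ = size-< (delete A e₀) A e₀ (delete-⊑ A e₀) (delete-removes A e₀) a₀

  Adjacent : ∀ {m p q} (L : Fin m → Fin p) (R : Fin m → Fin q) → Fin m → Fin m → Set
  Adjacent L R e e' = L e ≡ L e' ⊎ R e ≡ R e'

  adjacent-sym : ∀ {m p q} {L : Fin m → Fin p} {R : Fin m → Fin q} {e e'} →
    Adjacent L R e e' → Adjacent L R e' e
  adjacent-sym (inj₁ l) = inj₁ (sym l)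
  adjacent-sym (inj₂ r) = inj₂ (sym r)

  ProperOn : ∀ {m p q} {C : Set} (L : Fin m → Fin p) (R : Fin m → Fin q) → EdgeSet m → (Fin m → C) → Set
  ProperOn L R A c = ∀ e e' → e ≢ e' → T (A e) → T (A e') → Adjacent L R e e' → c e ≢ c e'

  ProperOn-swap : ∀ {m p q} {C : Set} (L : Fin m → Fin p) (R : Fin m → Fin q) A (c : Fin m → C) →
    ProperOn R L A c → ProperOn L R A c
  ProperOn-swap L R A c proper e e' e≢e' a a' adj = proper e e' e≢e' a a' (swap adj)

  MaxDegree : ∀ {m p} → ℕ → (Fin m → Fin p) → EdgeSet m → Set
  MaxDegree {m} D f A = ∀ (g : Fin (suc D) → Fin m) → Inj g → (∀ i → T (A (g i))) →
                        (∀ i → f (g i) ≡ f (g zero)) → ⊥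

  MaxDegree-⊑ : ∀ {m p D} (f : Fin m → Fin p) A B → A ⊑ B → MaxDegree D f B → MaxDegree D f A
  MaxDegree-⊑ f A B A⊑B max g g-inj inA same = max g g-inj (λ i → A⊑B _ (inA i)) same

  MaxDegree-by-labels : ∀ {m p D} (f : Fin m → Fin p) (A : EdgeSet m) (ψ : Fin m → Fin D) →
    (∀ e e' → T (A e) → T (A e') → f e ≡ f e' → ψ e ≡ ψ e' → e ≡ e') → MaxDegree D f A
  MaxDegree-by-labels f A ψ separates g g-inj inA same = ℕP.<-irrefl refl (injective⇒≤ {f = λ i → ψ (g i)}
    (λ {i} {j} eq → g-inj (separates (g i) (g j) (inA i) (inA j) (trans (same i) (sym (same j))) eq)))

  MaxDegree2 : ∀ {m p} → (Fin m → Fin p) → EdgeSet m → Set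
  MaxDegree2 f A = ∀ e₁ e₂ e₃ → e₁ ≢ e₂ → e₁ ≢ e₃ → e₂ ≢ e₃ → T (A e₁) → T (A e₂) → T (A e₃) →
                   f e₁ ≡ f e₂ → f e₁ ≡ f e₃ → ⊥

  MaxDegree2-⊑ : ∀ {m p} (f : Fin m → Fin p) A B → A ⊑ B → MaxDegree2 f B → MaxDegree2 f A
  MaxDegree2-⊑ f A B A⊑B max e₁ e₂ e₃ n₁₂ n₁₃ n₂₃ a₁ a₂ a₃ =
    max e₁ e₂ e₃ n₁₂ n₁₃ n₂₃ (A⊑B _ a₁) (A⊑B _ a₂) (A⊑B _ a₃)

-- Induction on the number of edges: if two edges e₀, e₁ share a left endpoint,
-- delete both and identify their right endpoints v = R e₀ and w = R e₁; the
-- result still has maximum degree 2 (v and w each kept at most one edge).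
-- A colouring of the contracted graph lifts back by giving e₀ and e₁ opposite
-- colours, e₀ the colour opposite to the remaining edge at v (or e₁ that opposite
-- to the remaining edge at w): those two remaining edges are adjacent in the
-- contracted graph, so both requirements agree.
module TwoColouring where
  open Multigraphs

  module Contract {m p q} (L : Fin m → Fin p) (R : Fin m → Fin q) (A : EdgeSet m)
    (e₀ e₁ : Fin m) (e₀≢e₁ : e₀ ≢ e₁) (a₀ : T (A e₀)) (a₁ : T (A e₁)) (sameL : L e₀ ≡ L e₁)
    (degL : MaxDegree2 L A) (degR : MaxDegree2 R A) where

    merge : Fin q → Fin q
    merge v with v ≟ R e₁
    ... | yes _ = R e₀
    ... | no _ = v

    merge-merged : ∀ v → v ≡ R e₁ → merge v ≡ R e₀
    merge-merged v eq with v ≟ R e₁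
    ... | yes _ = refl
    ... | no ne = ⊥-elim (ne eq)

    merge-other : ∀ v → v ≢ R e₁ → merge v ≡ v
    merge-other v ne with v ≟ R e₁
    ... | yes eq = ⊥-elim (ne eq)
    ... | no _ = refl

    R′ : Fin m → Fin q
    R′ e = merge (R e)

    A′ : EdgeSet m
    A′ = delete (delete A e₀) e₁

    A′⊑A : A′ ⊑ A
    A′⊑A e t = delete-⊑ A e₀ e (delete-⊑ (delete A e₀) e₁ e t)

    A′-≢₀ : ∀ e → T (A′ e) → e ≢ e₀
    A′-≢₀ e t = delete-≢ A e₀ e (delete-⊑ (delete A e₀) e₁ e t)

    A′-≢₁ : ∀ e → T (A′ e) → e ≢ e₁
    A′-≢₁ e t = delete-≢ (delete A e₀) e₁ e t

    A′-keeps : ∀ e → e ≢ e₀ → e ≢ e₁ → T (A e) → T (A′ e)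
    A′-keeps e n₀ n₁ t = delete-keeps (delete A e₀) e₁ e n₁ (delete-keeps A e₀ e n₀ t)

    A′-smaller : size A′ < size A
    A′-smaller = ℕP.≤-<-trans (size-mono A′ (delete A e₀) (delete-⊑ (delete A e₀) e₁)) (delete-< A e₀ a₀)

    degL′ : MaxDegree2 L A′
    degL′ = MaxDegree2-⊑ L A′ A A′⊑A degL

    lone-at-v : ∀ g h → g ≢ h → T (A′ g) → T (A′ h) → R g ≡ R e₀ → R h ≡ R e₀ → ⊥
    lone-at-v g h g≢h ag ah rg rh =
      degR e₀ g h (λ eq → A′-≢₀ g ag (sym eq)) (λ eq → A′-≢₀ h ah (sym eq)) g≢h
           a₀ (A′⊑A g ag) (A′⊑A h ah) (sym rg) (sym rh)

    lone-at-w : ∀ g h → g ≢ h → T (A′ g) → T (A′ h) → R g ≡ R e₁ → R h ≡ R e₁ → ⊥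
    lone-at-w g h g≢h ag ah rg rh =
      degR e₁ g h (λ eq → A′-≢₁ g ag (sym eq)) (λ eq → A′-≢₁ h ah (sym eq)) g≢h
           a₁ (A′⊑A g ag) (A′⊑A h ah) (sym rg) (sym rh)

    at-merged : ∀ g → R′ g ≡ R e₀ → R g ≡ R e₀ ⊎ R g ≡ R e₁
    at-merged g eq with R g ≟ R e₁
    ... | yes at-w = inj₂ at-w
    ... | no _ = inj₁ eq

    away-from-merged : ∀ g → R′ g ≢ R e₀ → R′ g ≡ R g
    away-from-merged g ne with R g ≟ R e₁
    ... | yes _ = ⊥-elim (ne refl)
    ... | no _ = refl

    degR′ : MaxDegree2 R′ A′
    degR′ g₁ g₂ g₃ n₁₂ n₁₃ n₂₃ a₁′ a₂′ a₃′ r₁₂ r₁₃ with R′ g₁ ≟ R e₀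
    ... | no ne = degR g₁ g₂ g₃ n₁₂ n₁₃ n₂₃ (A′⊑A _ a₁′) (A′⊑A _ a₂′) (A′⊑A _ a₃′)
            (trans (sym (away-from-merged g₁ ne)) (trans r₁₂ (away-from-merged g₂ (λ e → ne (trans r₁₂ e)))))
            (trans (sym (away-from-merged g₁ ne)) (trans r₁₃ (away-from-merged g₃ (λ e → ne (trans r₁₃ e)))))
    ... | yes z with at-merged g₁ z | at-merged g₂ (trans (sym r₁₂) z) | at-merged g₃ (trans (sym r₁₃) z)
    ... | inj₁ x | inj₁ y | _ = lone-at-v g₁ g₂ n₁₂ a₁′ a₂′ x y
    ... | inj₁ x | inj₂ y | inj₁ w = lone-at-v g₁ g₃ n₁₃ a₁′ a₃′ x w
    ... | inj₁ x | inj₂ y | inj₂ w = lone-at-w g₂ g₃ n₂₃ a₂′ a₃′ y w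
    ... | inj₂ x | inj₁ y | inj₁ w = lone-at-v g₂ g₃ n₂₃ a₂′ a₃′ y w
    ... | inj₂ x | inj₁ y | inj₂ w = lone-at-w g₁ g₃ n₁₃ a₁′ a₃′ x w
    ... | inj₂ x | inj₂ y | _ = lone-at-w g₁ g₂ n₁₂ a₁′ a₂′ x y

    module Lift (c : Fin m → Bool) (proper′ : ProperOn L R′ A′ c) where

      EdgeAt : Fin q → Set
      EdgeAt v = ∃ λ f → T (A′ f) × R f ≡ v

      edgeAt? : ∀ v → Dec (EdgeAt v)
      edgeAt? v = any? (λ f → T? (A′ f) ×-dec (R f ≟ v))

      -- the colour of e₀ (e₁ gets the opposite one)
      choose : Dec (EdgeAt (R e₀)) → Dec (EdgeAt (R e₁)) → Bool
      choose (yes (f , _)) _ = not (c f)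
      choose (no _) (yes (g , _)) = c g
      choose (no _) (no _) = true

      x₀ : Bool
      x₀ = choose (edgeAt? (R e₀)) (edgeAt? (R e₁))

      recolour : ∀ {P Q : Set} → Dec P → Dec Q → Bool → Bool
      recolour (yes _) _ _ = x₀
      recolour (no _) (yes _) _ = not x₀
      recolour (no _) (no _) b = b

      c↑ : Fin m → Bool
      c↑ e = recolour (e ≟ e₀) (e ≟ e₁) (c e)

      c↑-e₀ : c↑ e₀ ≡ x₀
      c↑-e₀ with e₀ ≟ e₀
      ... | yes _ = refl
      ... | no ne = ⊥-elim (ne refl)

      c↑-e₁ : c↑ e₁ ≡ not x₀
      c↑-e₁ with e₁ ≟ e₀
      ... | yes eq = ⊥-elim (e₀≢e₁ (sym eq))
      ... | no _ with e₁ ≟ e₁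
      ... | yes _ = refl
      ... | no ne = ⊥-elim (ne refl)

      c↑-other : ∀ e → e ≢ e₀ → e ≢ e₁ → c↑ e ≡ c e
      c↑-other e n₀ n₁ with e ≟ e₀
      ... | yes eq = ⊥-elim (n₀ eq)
      ... | no _ with e ≟ e₁
      ... | yes eq = ⊥-elim (n₁ eq)
      ... | no _ = refl

      unique-at-v : ∀ f g → T (A′ f) → T (A′ g) → R f ≡ R e₀ → R g ≡ R e₀ → f ≡ g
      unique-at-v f g af ag rf rg with f ≟ g
      ... | yes eq = eq
      ... | no ne = ⊥-elim (lone-at-v f g ne af ag rf rg)

      unique-at-w : ∀ f g → T (A′ f) → T (A′ g) → R f ≡ R e₁ → R g ≡ R e₁ → f ≡ g
      unique-at-w f g af ag rf rg with f ≟ g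
      ... | yes eq = eq
      ... | no ne = ⊥-elim (lone-at-w f g ne af ag rf rg)

      b≢not-b : ∀ b → b ≢ not b
      b≢not-b b = BoolP.not-¬ refl

      only-two-at-u : ∀ e' → e' ≢ e₀ → e' ≢ e₁ → T (A e') → L e₀ ≢ L e'
      only-two-at-u e' n₀ n₁ a' l =
        degL e₀ e₁ e' e₀≢e₁ (λ eq → n₀ (sym eq)) (λ eq → n₁ (sym eq)) a₀ a₁ a' sameL l

      v≢w : ∀ e' → e' ≢ e₀ → e' ≢ e₁ → T (A e') → R e₁ ≡ R e' → R e₀ ≢ R e₁
      v≢w e' n₀ n₁ a' r eq =
        degR e₀ e₁ e' e₀≢e₁ (λ x → n₀ (sym x)) (λ x → n₁ (sym x)) a₀ a₁ a' eq (trans eq r)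

      e₀-ok : ∀ e' → e' ≢ e₀ → T (A e') → Adjacent L R e₀ e' → x₀ ≢ c↑ e'
      e₀-ok e' n₀ a' adj = by-cases (e' ≟ e₁)
        where
        clash : e' ≢ e₁ → Adjacent L R e₀ e' → x₀ ≢ c e'
        clash n₁ (inj₁ l) = ⊥-elim (only-two-at-u e' n₀ n₁ a' l)
        clash n₁ (inj₂ r) with edgeAt? (R e₀) | edgeAt? (R e₁)
        ... | yes (f , af , rf) | _
          rewrite unique-at-v f e' af (A′-keeps e' n₀ n₁ a') rf (sym r) = λ eq → b≢not-b (c e') (sym eq)
        ... | no none | _ = ⊥-elim (none (e' , A′-keeps e' n₀ n₁ a' , sym r))
        by-cases : Dec (e' ≡ e₁) → x₀ ≢ c↑ e'
        by-cases (yes refl) h = b≢not-b x₀ (trans h c↑-e₁)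
        by-cases (no n₁) h = clash n₁ adj (trans h (c↑-other e' n₀ n₁))

      e₁-ok : ∀ e' → e' ≢ e₁ → T (A e') → Adjacent L R e₁ e' → not x₀ ≢ c↑ e'
      e₁-ok e' n₁ a' adj = by-cases (e' ≟ e₀)
        where
        clash : e' ≢ e₀ → Adjacent L R e₁ e' → not x₀ ≢ c e'
        clash n₀ (inj₁ l) = ⊥-elim (only-two-at-u e' n₀ n₁ a' (trans sameL l))
        clash n₀ (inj₂ r) with edgeAt? (R e₀) | edgeAt? (R e₁)
        ... | yes (f , af , rf) | _ = λ eq →
          proper′ f e' f≢e' af a′ (inj₂ (trans (merge-other (R f) f≢w) (trans rf (sym (merge-merged (R e') (sym r))))))
                  (trans (sym (BoolP.not-involutive (c f))) eq)
          where
          a′ = A′-keeps e' n₀ n₁ a'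
          f≢w : R f ≢ R e₁
          f≢w x = v≢w e' n₀ n₁ a' r (trans (sym rf) x)
          f≢e' : f ≢ e'
          f≢e' refl = f≢w (sym r)
        ... | no _ | yes (g , ag , rg)
          rewrite unique-at-w g e' ag (A′-keeps e' n₀ n₁ a') rg (sym r) = λ eq → b≢not-b (c e') (sym eq)
        ... | no _ | no none = ⊥-elim (none (e' , A′-keeps e' n₀ n₁ a' , sym r))
        by-cases : Dec (e' ≡ e₀) → not x₀ ≢ c↑ e'
        by-cases (yes refl) h = b≢not-b x₀ (sym (trans h c↑-e₀))
        by-cases (no n₀) h = clash n₀ adj (trans h (c↑-other e' n₀ n₁))

      lift-cases : ∀ e e' → e ≢ e' → T (A e) → T (A e') → Adjacent L R e e' →
        Dec (e ≡ e₀) → Dec (e ≡ e₁) → Dec (e' ≡ e₀) → Dec (e' ≡ e₁) → c↑ e ≢ c↑ e'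
      lift-cases e e' e≢e' a a' adj (yes refl) _ _ _ h =
        e₀-ok e' (λ x → e≢e' (sym x)) a' adj (trans (sym c↑-e₀) h)
      lift-cases e e' e≢e' a a' adj (no _) (yes refl) _ _ h =
        e₁-ok e' (λ x → e≢e' (sym x)) a' adj (trans (sym c↑-e₁) h)
      lift-cases e e' e≢e' a a' adj (no n₀) (no _) (yes refl) _ h =
        e₀-ok e n₀ a (adjacent-sym {L = L} {R = R} adj) (trans (sym c↑-e₀) (sym h))
      lift-cases e e' e≢e' a a' adj (no _) (no n₁) (no _) (yes refl) h =
        e₁-ok e n₁ a (adjacent-sym {L = L} {R = R} adj) (trans (sym c↑-e₁) (sym h))
      lift-cases e e' e≢e' a a' adj (no n₀) (no n₁) (no n₀') (no n₁') h =
        proper′ e e' e≢e' (A′-keeps e n₀ n₁ a) (A′-keeps e' n₀' n₁' a') (map₂ (cong merge) adj)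
                (trans (sym (c↑-other e n₀ n₁)) (trans h (c↑-other e' n₀' n₁')))
    
      lift : ProperOn L R A c↑
      lift e e' e≢e' a a' adj = lift-cases e e' e≢e' a a' adj (e ≟ e₀) (e ≟ e₁) (e' ≟ e₀) (e' ≟ e₁)

  Pair : ∀ {m p} → (Fin m → Fin p) → EdgeSet m → Fin m → Fin m → Set
  Pair f A e₀ e₁ = e₀ ≢ e₁ × T (A e₀) × T (A e₁) × f e₀ ≡ f e₁

  pair? : ∀ {m p} (f : Fin m → Fin p) A e₀ e₁ → Dec (Pair f A e₀ e₁)
  pair? f A e₀ e₁ = ¬? (e₀ ≟ e₁) ×-dec (T? (A e₀) ×-dec (T? (A e₁) ×-dec (f e₀ ≟ f e₁)))

  two-colouring-fuel : ∀ k {m p q} (L : Fin m → Fin p) (R : Fin m → Fin q) (A : EdgeSet m) → size A < k →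
    MaxDegree2 L A → MaxDegree2 R A → Σ (Fin m → Bool) (ProperOn L R A)
  two-colouring-fuel zero L R A () degL degR
  two-colouring-fuel (suc k) L R A lt degL degR
    with any? (λ e₀ → any? (λ e₁ → pair? L A e₀ e₁))
  ... | yes (e₀ , e₁ , e₀≢e₁ , a₀ , a₁ , sameL) =
    let open Contract L R A e₀ e₁ e₀≢e₁ a₀ a₁ sameL degL degR
        (c , proper) = two-colouring-fuel k L R′ A′ (ℕP.<-≤-trans A′-smaller (ℕP.≤-pred lt)) degL′ degR′
    in Lift.c↑ c proper , Lift.lift c proper
  ... | no noPairL with any? (λ e₀ → any? (λ e₁ → pair? R A e₀ e₁))
  ... | yes (e₀ , e₁ , e₀≢e₁ , a₀ , a₁ , sameR) =
    let open Contract R L A e₀ e₁ e₀≢e₁ a₀ a₁ sameR degR degL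
        (c , proper) = two-colouring-fuel k R R′ A′ (ℕP.<-≤-trans A′-smaller (ℕP.≤-pred lt)) degL′ degR′
    in Lift.c↑ c proper , ProperOn-swap L R A _ (Lift.lift c proper)
  ... | no noPairR = (λ _ → true) , constant-proper
    where
    constant-proper : ProperOn L R A (λ _ → true)
    constant-proper e e' ne a a' (inj₁ l) _ = noPairL (e , e' , ne , a , a' , l)
    constant-proper e e' ne a a' (inj₂ r) _ = noPairR (e , e' , ne , a , a' , r)

  two-colouring : ∀ {m p q} (L : Fin m → Fin p) (R : Fin m → Fin q) (A : EdgeSet m) →
    MaxDegree2 L A → MaxDegree2 R A → Σ (Fin m → Bool) (ProperOn L R A)
  two-colouring L R A = two-colouring-fuel (suc (size A)) L R A ℕP.≤-refl

-- Induction on the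
-- number of edges: colour all edges but one edge e₀, pick a colour α missing at
-- the left endpoint of e₀ and β missing at its right endpoint.  If α = β give
-- e₀ that colour.  Otherwise the edges coloured α or β together with e₀ form a
-- subgraph of maximum degree 2; recolour it with {α, β} by `two-colouring`.
module König where
  open Multigraphs
  open TwoColouring using (two-colouring)

  free-colour : ∀ {m p D} (f : Fin m → Fin p) (A A′ : EdgeSet m) (c : Fin m → Fin D) e₀ →
    A′ ⊑ A → ¬ T (A′ e₀) → T (A e₀) → MaxDegree D f A →
    ∃ λ α → ∀ e → T (A′ e) → f e ≡ f e₀ → c e ≢ α
  free-colour {m} {p} {D} f A A′ c e₀ A′⊑A ¬a₀ a₀ maxDeg with any? (λ α → ¬? (used? α))
    where
    used? : ∀ α → Dec (∃ λ e → T (A′ e) × f e ≡ f e₀ × c e ≡ α)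
    used? α = any? (λ e → T? (A′ e) ×-dec ((f e ≟ f e₀) ×-dec (c e ≟ α)))
  ... | yes (α , unused) = α , λ e a fe ce → unused (e , a , fe , ce)
  ... | no allUsed = ⊥-elim (maxDeg g g-inj inA sameEnd)
    where
    -- if every colour is used at f e₀, e₀ and one edge per colour are D + 1 edges there
    user : ∀ α → ∃ λ e → T (A′ e) × f e ≡ f e₀ × c e ≡ α
    user α with any? (λ e → T? (A′ e) ×-dec ((f e ≟ f e₀) ×-dec (c e ≟ α)))
    ... | yes u = u
    ... | no nu = ⊥-elim (allUsed (α , nu))
    g : Fin (suc D) → Fin m
    g zero = e₀
    g (suc α) = proj₁ (user α)
    g-inj : Inj g
    g-inj {zero} {zero} _ = refl
    g-inj {zero} {suc β} eq = ⊥-elim (¬a₀ (subst (λ z → T (A′ z)) (sym eq) (proj₁ (proj₂ (user β)))))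
    g-inj {suc α} {zero} eq = ⊥-elim (¬a₀ (subst (λ z → T (A′ z)) eq (proj₁ (proj₂ (user α)))))
    g-inj {suc α} {suc β} eq =
      cong suc (trans (sym (proj₂ (proj₂ (proj₂ (user α))))) (trans (cong c eq) (proj₂ (proj₂ (proj₂ (user β))))))
    inA : ∀ i → T (A (g i))
    inA zero = a₀
    inA (suc α) = A′⊑A _ (proj₁ (proj₂ (user α)))
    sameEnd : ∀ i → f (g i) ≡ f (g zero)
    sameEnd zero = refl
    sameEnd (suc α) = proj₁ (proj₂ (proj₂ (user α)))

  three-in-two : ∀ {C : Set} {α β x y z : C} → (x ≡ α ⊎ x ≡ β) → (y ≡ α ⊎ y ≡ β) → (z ≡ α ⊎ z ≡ β) →
    x ≢ y → x ≢ z → y ≢ z → ⊥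
  three-in-two (inj₁ refl) (inj₁ refl) _ x≢y _ _ = x≢y refl
  three-in-two (inj₁ refl) (inj₂ refl) (inj₁ refl) _ x≢z _ = x≢z refl
  three-in-two (inj₁ refl) (inj₂ refl) (inj₂ refl) _ _ y≢z = y≢z refl
  three-in-two (inj₂ refl) (inj₁ refl) (inj₁ refl) _ _ y≢z = y≢z refl
  three-in-two (inj₂ refl) (inj₁ refl) (inj₂ refl) _ x≢z _ = x≢z refl
  three-in-two (inj₂ refl) (inj₂ refl) _ x≢y _ _ = x≢y refl

  module Extend {m p q D} (L : Fin m → Fin p) (R : Fin m → Fin q) (A : EdgeSet m) (e₀ : Fin m) (a₀ : T (A e₀))
    (c : Fin m → Fin D) (proper : ProperOn L R (delete A e₀) c)
    (α : Fin D) (α-free : ∀ e → T (delete A e₀ e) → L e ≡ L e₀ → c e ≢ α)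
    (β : Fin D) (β-free : ∀ e → T (delete A e₀ e) → R e ≡ R e₀ → c e ≢ β) where

    A′ = delete A e₀

    paint : Fin m → Fin D
    paint e with e ≟ e₀
    ... | yes _ = α
    ... | no _ = c e

    paint-e₀ : ∀ e → e ≡ e₀ → paint e ≡ α
    paint-e₀ e eq with e ≟ e₀
    ... | yes _ = refl
    ... | no ne = ⊥-elim (ne eq)

    paint-other : ∀ e → e ≢ e₀ → paint e ≡ c e
    paint-other e ne with e ≟ e₀
    ... | yes eq = ⊥-elim (ne eq)
    ... | no _ = refl

    α-ok : α ≡ β → ∀ e' → e' ≢ e₀ → T (A e') → Adjacent L R e₀ e' → α ≢ c e'
    α-ok α≡β e' ne a (inj₁ l) h = α-free e' (delete-keeps A e₀ e' ne a) (sym l) (sym h)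
    α-ok α≡β e' ne a (inj₂ r) h = β-free e' (delete-keeps A e₀ e' ne a) (sym r) (sym (trans (sym α≡β) h))

    paint-proper : α ≡ β → ProperOn L R A paint
    paint-proper α≡β e e' e≢e' a a' adj = by-cases (e ≟ e₀) (e' ≟ e₀)
      where
      by-cases : Dec (e ≡ e₀) → Dec (e' ≡ e₀) → paint e ≢ paint e'
      by-cases (yes refl) _ h =
        α-ok α≡β e' (λ x → e≢e' (sym x)) a' adj (trans (sym (paint-e₀ e refl)) (trans h (paint-other e' (λ x → e≢e' (sym x)))))
      by-cases (no n) (yes refl) h =
        α-ok α≡β e n a (adjacent-sym {L = L} {R = R} adj) (trans (sym (paint-e₀ e' refl)) (trans (sym h) (paint-other e n)))
      by-cases (no n) (no n') h =
        proper e e' e≢e' (delete-keeps A e₀ e n a) (delete-keeps A e₀ e' n' a') adj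
               (trans (sym (paint-other e n)) (trans h (paint-other e' n')))

    InAB : Fin m → Set
    InAB e = e ≡ e₀ ⊎ (T (A′ e) × (c e ≡ α ⊎ c e ≡ β))

    AB : EdgeSet m
    AB e = ⌊ (e ≟ e₀) ⊎-dec (T? (A′ e) ×-dec ((c e ≟ α) ⊎-dec (c e ≟ β))) ⌋

    AB⁻ : ∀ e → T (AB e) → InAB e
    AB⁻ e = toWitness

    AB⁺ : ∀ e → InAB e → T (AB e)
    AB⁺ e = fromWitness

    -- AB has maximum degree 2 on the side f, where γ is the colour free at
    -- f e₀ and δ the other one of α, β
    AB-degree2 : ∀ {r} (f : Fin m → Fin r) →
      (∀ e e' → e ≢ e' → T (A′ e) → T (A′ e') → f e ≡ f e' → c e ≢ c e') →
      (γ δ : Fin D) → (∀ x → (x ≡ α ⊎ x ≡ β) → x ≢ γ → x ≡ δ) →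
      (∀ e → T (A′ e) → f e ≡ f e₀ → c e ≢ γ) → MaxDegree2 f AB
    AB-degree2 f proper-f γ δ is-δ γ-free g₁ g₂ g₃ n₁₂ n₁₃ n₂₃ t₁ t₂ t₃ r₁₂ r₁₃
      with AB⁻ g₁ t₁ | AB⁻ g₂ t₂ | AB⁻ g₃ t₃
    ... | inj₁ refl | inj₁ refl | _ = n₁₂ refl
    ... | inj₁ refl | inj₂ _ | inj₁ refl = n₁₃ refl
    ... | _ | inj₁ refl | inj₁ refl = n₂₃ refl
    ... | inj₁ refl | inj₂ (a₂ , k₂) | inj₂ (a₃ , k₃) =
          proper-f g₂ g₃ n₂₃ a₂ a₃ (trans (sym r₁₂) r₁₃)
            (trans (is-δ _ k₂ (γ-free g₂ a₂ (sym r₁₂))) (sym (is-δ _ k₃ (γ-free g₃ a₃ (sym r₁₃)))))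
    ... | inj₂ (a₁ , k₁) | inj₁ refl | inj₂ (a₃ , k₃) =
          proper-f g₁ g₃ n₁₃ a₁ a₃ r₁₃
            (trans (is-δ _ k₁ (γ-free g₁ a₁ r₁₂)) (sym (is-δ _ k₃ (γ-free g₃ a₃ (trans (sym r₁₃) r₁₂)))))
    ... | inj₂ (a₁ , k₁) | inj₂ (a₂ , k₂) | inj₁ refl =
          proper-f g₁ g₂ n₁₂ a₁ a₂ r₁₂
            (trans (is-δ _ k₁ (γ-free g₁ a₁ r₁₃)) (sym (is-δ _ k₂ (γ-free g₂ a₂ (trans (sym r₁₂) r₁₃)))))
    ... | inj₂ (a₁ , k₁) | inj₂ (a₂ , k₂) | inj₂ (a₃ , k₃) =
          three-in-two k₁ k₂ k₃ (proper-f g₁ g₂ n₁₂ a₁ a₂ r₁₂) (proper-f g₁ g₃ n₁₃ a₁ a₃ r₁₃)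
                       (proper-f g₂ g₃ n₂₃ a₂ a₃ (trans (sym r₁₂) r₁₃))

    module Recolour (α≢β : α ≢ β) where
      other-than-α : ∀ x → (x ≡ α ⊎ x ≡ β) → x ≢ α → x ≡ β
      other-than-α x (inj₁ eq) ne = ⊥-elim (ne eq)
      other-than-α x (inj₂ eq) _ = eq

      other-than-β : ∀ x → (x ≡ α ⊎ x ≡ β) → x ≢ β → x ≡ α
      other-than-β x (inj₁ eq) _ = eq
      other-than-β x (inj₂ eq) ne = ⊥-elim (ne eq)

      AB-degL : MaxDegree2 L AB
      AB-degL = AB-degree2 L (λ e e' ne a a' l → proper e e' ne a a' (inj₁ l)) α β other-than-α α-free

      AB-degR : MaxDegree2 R AB
      AB-degR = AB-degree2 R (λ e e' ne a a' r → proper e e' ne a a' (inj₂ r)) β α other-than-β β-free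

      AB-colouring : Σ (Fin m → Bool) (ProperOn L R AB)
      AB-colouring = two-colouring L R AB AB-degL AB-degR

      toColour : Bool → Fin D
      toColour true = α
      toColour false = β

      toColour-≢ : ∀ b b' → b ≢ b' → toColour b ≢ toColour b'
      toColour-≢ true true ne _ = ne refl
      toColour-≢ true false _ eq = α≢β eq
      toColour-≢ false true _ eq = α≢β (sym eq)
      toColour-≢ false false ne _ = ne refl

      toColour-αβ : ∀ b → toColour b ≡ α ⊎ toColour b ≡ β
      toColour-αβ true = inj₁ refl
      toColour-αβ false = inj₂ refl

      choose : ∀ {P : Set} → Dec P → Bool → Fin D → Fin D
      choose (yes _) b _ = toColour b
      choose (no _) _ x = x

      c′ : Fin m → Fin D
      c′ e = choose (T? (AB e)) (proj₁ AB-colouring e) (c e)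

      c′-in : ∀ e → T (AB e) → c′ e ≡ toColour (proj₁ AB-colouring e)
      c′-in e t with T? (AB e)
      ... | yes _ = refl
      ... | no n = ⊥-elim (n t)

      c′-out : ∀ e → ¬ T (AB e) → c′ e ≡ c e
      c′-out e n with T? (AB e)
      ... | yes t = ⊥-elim (n t)
      ... | no _ = refl

      ¬AB⇒≢e₀ : ∀ {e} → ¬ T (AB e) → e ≢ e₀
      ¬AB⇒≢e₀ n refl = n (AB⁺ _ (inj₁ refl))

      -- an edge outside AB keeps a colour other than α, β
      across : ∀ e e' → T (AB e) → ¬ T (AB e') → T (A e') → c′ e ≢ c′ e'
      across e e' t n a' h = n (AB⁺ e' (inj₂ (delete-keeps A e₀ e' (¬AB⇒≢e₀ n) a' , αβ)))
        where
        αβ : c e' ≡ α ⊎ c e' ≡ β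
        αβ = subst (λ z → z ≡ α ⊎ z ≡ β) (trans (trans (sym (c′-in e t)) h) (c′-out e' n))
                   (toColour-αβ (proj₁ AB-colouring e))

      c′-proper : ProperOn L R A c′
      c′-proper e e' e≢e' a a' adj = by-cases (T? (AB e)) (T? (AB e'))
        where
        by-cases : Dec (T (AB e)) → Dec (T (AB e')) → c′ e ≢ c′ e'
        by-cases (yes t) (yes t') h =
          toColour-≢ _ _ (proj₂ AB-colouring e e' e≢e' t t' adj) (trans (sym (c′-in e t)) (trans h (c′-in e' t')))
        by-cases (yes t) (no n') = across e e' t n' a'
        by-cases (no n) (yes t') h = across e' e t' n a (sym h)
        by-cases (no n) (no n') h =
          proper e e' e≢e' (delete-keeps A e₀ e (¬AB⇒≢e₀ n) a) (delete-keeps A e₀ e' (¬AB⇒≢e₀ n') a') adj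
                 (trans (sym (c′-out e n)) (trans h (c′-out e' n')))

  konig-fuel : ∀ k {m p q} D (L : Fin m → Fin p) (R : Fin m → Fin q) (A : EdgeSet m) → size A < k →
    MaxDegree (suc D) L A → MaxDegree (suc D) R A → Σ (Fin m → Fin (suc D)) (ProperOn L R A)
  konig-fuel zero D L R A () degL degR
  konig-fuel (suc k) D L R A lt degL degR with any? (λ e → T? (A e))
  ... | no empty = (λ _ → zero) , λ e _ _ a _ _ _ → empty (e , a)
  ... | yes (e₀ , a₀) = extended
    where
    A′ = delete A e₀
    A′⊑A = delete-⊑ A e₀
    rest = konig-fuel k D L R A′ (ℕP.<-≤-trans (delete-< A e₀ a₀) (ℕP.≤-pred lt))
                 (MaxDegree-⊑ L A′ A A′⊑A degL) (MaxDegree-⊑ R A′ A A′⊑A degR)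
    freeL = free-colour L A A′ (proj₁ rest) e₀ A′⊑A (delete-removes A e₀) a₀ degL
    freeR = free-colour R A A′ (proj₁ rest) e₀ A′⊑A (delete-removes A e₀) a₀ degR
    open Extend L R A e₀ a₀ (proj₁ rest) (proj₂ rest) (proj₁ freeL) (proj₂ freeL) (proj₁ freeR) (proj₂ freeR)
    extended : Σ (Fin _ → Fin (suc D)) (ProperOn L R A)
    extended with proj₁ freeL ≟ proj₁ freeR
    ... | yes α≡β = paint , paint-proper α≡β
    ... | no α≢β = Recolour.c′ α≢β , Recolour.c′-proper α≢β

  konig : ∀ {m p q} D (L : Fin m → Fin p) (R : Fin m → Fin q) (A : EdgeSet m) →
    MaxDegree (suc D) L A → MaxDegree (suc D) R A → Σ (Fin m → Fin (suc D)) (ProperOn L R A)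
  konig D L R A = konig-fuel (suc (size A)) D L R A ℕP.≤-refl

module Neighbourhoods (G : Graph) where
  open Counting using (lookup-injective)

  N : ℕ
  N = n G

  adj-sym : ∀ u v → T (adj G u v) → T (adj G v u)
  adj-sym u v a = subst T (Graph.sym G u v) a

  -- `degree G v` is by definition the length of this list
  neighbours : Fin N → List (Fin N)
  neighbours v = filter (λ u → T? (adj G v u)) (allFin N)

  neighbours-unique : ∀ v → Unique (neighbours v)
  neighbours-unique v = filter⁺ (λ u → T? (adj G v u)) (allFin⁺ N)

  module Enumerate (v : Fin N) {d : ℕ} (deg : degree G v ≡ d) where

    nbr : Fin d → Fin N
    nbr p = List.lookup (neighbours v) (cast (sym deg) p)

    nbr-adj : ∀ p → T (adj G v (nbr p))
    nbr-adj p = proj₂ (∈-filter⁻ (λ u → T? (adj G v u)) {xs = allFin N} (∈-lookup (cast (sym deg) p)))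

    nbr-inj : Inj nbr
    nbr-inj eq = cast-injective (lookup-injective (neighbours-unique v) eq)
      where
      cast-injective : Inj (cast (sym deg))
      cast-injective {i} {j} e = trans (sym (cast-involutive deg (sym deg) i))
                                       (trans (cong (cast deg) e) (cast-involutive deg (sym deg) j))

    index-of : ∀ u → T (adj G v u) → Fin d
    index-of u a = cast deg (index (∈-filter⁺ (λ u → T? (adj G v u)) (∈-allFin u) a))

    nbr-index : ∀ u a → nbr (index-of u a) ≡ u
    nbr-index u a = begin
      List.lookup (neighbours v) (cast (sym deg) (cast deg i))  ≡⟨ cong (List.lookup (neighbours v)) (cast-involutive (sym deg) deg i) ⟩
      List.lookup (neighbours v) i                              ≡⟨ lookup-index u∈ ⟨
      u                                                         ∎
      where
      open ≡-Reasoning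
      u∈ = ∈-filter⁺ (λ u → T? (adj G v u)) (∈-allFin u) a
      i = index u∈

    index-inj : ∀ u u' a a' → index-of u a ≡ index-of u' a' → u ≡ u'
    index-inj u u' a a' eq = trans (sym (nbr-index u a)) (trans (cong nbr eq) (nbr-index u' a'))

    index-nbr : ∀ p a → index-of (nbr p) a ≡ p
    index-nbr p a = nbr-inj (nbr-index (nbr p) a)

module Sides (G : Graph) (a b : ℕ) (bireg : Biregular a b G) where

  side : Fin (n G) → Bool
  side = proj₁ bireg

  cross : ∀ u v → adj G u v ≡ true → side u ≢ side v
  cross = proj₁ (proj₂ bireg)

  degX : ∀ v → side v ≡ false → degree G v ≡ a
  degX = proj₁ (proj₂ (proj₂ bireg))

  degY : ∀ v → side v ≡ true → degree G v ≡ b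
  degY = proj₂ (proj₂ (proj₂ bireg))

  X-to-Y : ∀ u v → T (adj G u v) → side u ≡ false → side v ≡ true
  X-to-Y u v a su with side v in sv
  ... | true = refl
  ... | false = ⊥-elim (cross u v (to BoolP.T-≡ a) (trans su (sym sv)))

  Y-to-X : ∀ u v → T (adj G u v) → side u ≡ true → side v ≡ false
  Y-to-X u v a su with side v in sv
  ... | false = refl
  ... | true = ⊥-elim (cross u v (to BoolP.T-≡ a) (trans su (sym sv)))

-- A vertex of degree 3k splits its neighbours into k triples ("groups"):
-- the neighbour with index i gets the slot (group, place) encoded by i.
module Slots (G : Graph) where
  open Neighbourhoods G

  toSlot : ∀ k → Fin (3 * k) → Fin k × Fin 3
  toSlot k i = remQuot {k} 3 (cast (ℕP.*-comm 3 k) i)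

  fromSlot : ∀ k → Fin k × Fin 3 → Fin (3 * k)
  fromSlot k (a , b) = cast (ℕP.*-comm k 3) (combine a b)

  toSlot-fromSlot : ∀ k c → toSlot k (fromSlot k c) ≡ c
  toSlot-fromSlot k (a , b) =
    trans (cong (remQuot 3) (cast-involutive (ℕP.*-comm 3 k) (ℕP.*-comm k 3) (combine a b))) (remQuot-combine a b)

  fromSlot-toSlot : ∀ k i → fromSlot k (toSlot k i) ≡ i
  fromSlot-toSlot k i =
    trans (cong (cast (ℕP.*-comm k 3)) (combine-remQuot {k} 3 (cast (ℕP.*-comm 3 k) i)))
          (cast-involutive (ℕP.*-comm k 3) (ℕP.*-comm 3 k) i)

  toSlot-inj : ∀ k → Inj (toSlot k)
  toSlot-inj k {i} {j} eq = trans (sym (fromSlot-toSlot k i)) (trans (cong (fromSlot k) eq) (fromSlot-toSlot k j))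

  -- the slot of the edge vu at v, when v has degree 3(k + 1); total for convenience
  slot : ∀ k → Fin N → Fin N → Fin (suc k) × Fin 3
  slot k v u with T? (adj G v u) | degree G v ℕ.≟ 3 * suc k
  ... | yes a | yes deg = toSlot (suc k) (Enumerate.index-of v deg u a)
  ... | _ | _ = zero , zero

  slot-≡ : ∀ k v u (a : T (adj G v u)) (deg : degree G v ≡ 3 * suc k) →
    slot k v u ≡ toSlot (suc k) (Enumerate.index-of v deg u a)
  slot-≡ k v u a deg with T? (adj G v u) | degree G v ℕ.≟ 3 * suc k
  ... | yes a' | yes _ rewrite BoolP.T-irrelevant a a' = refl
  ... | no ¬a | _ = ⊥-elim (¬a a)
  ... | yes _ | no ¬deg = ⊥-elim (¬deg deg)

  slot-inj : ∀ k v u u' → T (adj G v u) → T (adj G v u') → degree G v ≡ 3 * suc k →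
    slot k v u ≡ slot k v u' → u ≡ u'
  slot-inj k v u u' a a' deg eq =
    index-inj u u' a a' (toSlot-inj (suc k) (trans (sym (slot-≡ k v u a deg)) (trans eq (slot-≡ k v u' a' deg))))
    where open Enumerate v deg

  slot-onto : ∀ k v → degree G v ≡ 3 * suc k → ∀ c → ∃ λ u → T (adj G v u) × slot k v u ≡ c
  slot-onto k v deg c = nbr p , nbr-adj p , (begin
    slot k v (nbr p)                                    ≡⟨ slot-≡ k v (nbr p) (nbr-adj p) deg ⟩
    toSlot (suc k) (index-of (nbr p) (nbr-adj p))       ≡⟨ cong (toSlot (suc k)) (index-nbr p (nbr-adj p)) ⟩
    toSlot (suc k) (fromSlot (suc k) c)                 ≡⟨ toSlot-fromSlot (suc k) c ⟩
    c                                                   ∎)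
    where
    open Enumerate v deg
    open ≡-Reasoning
    p = fromSlot (suc k) c

module Palettes {G : Graph} {m : ℕ} (φ : EdgeColouring G m) where

  InPalette : Fin (n G) → Fin m → Set
  InPalette v c = lookup (palette φ v) c ≡ true

  palette-∋ : ∀ v u c → T (adj G v u) → col φ v u ≡ c → InPalette v c
  palette-∋ v u c a eq = trans (VecP.lookup∘tabulate _ c)
    (to BoolP.T-≡ (fromWitness (u , from BoolP.T-∧ (a , fromWitness eq))))

  palette-witness : ∀ v c → InPalette v c → ∃ λ u → T (adj G v u) × col φ v u ≡ c
  palette-witness v c inP with toWitness (from BoolP.T-≡ (trans (sym (VecP.lookup∘tabulate _ c)) inP))
  ... | u , t with to BoolP.T-∧ t
  ... | a , same = u , a , toWitness same

numPalettes-≤ : ∀ {G : Graph} {m : ℕ} (φ : EdgeColouring G m) (K : List (Vec Bool m)) →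
  (∀ v → palette φ v ∈ K) → numPalettes φ ≤ length K
numPalettes-≤ {G} {m} φ K all∈K =
  Counting.unique-length-≤ (deduplicate-! (VecP.≡-dec {n = m} BoolP._≟_) _) ⊆K
  where
  ⊆K : ∀ {z} → z ∈ deduplicate (VecP.≡-dec BoolP._≟_) (List.map (palette φ) (allFin (n G))) → z ∈ K
  ⊆K {z} z∈ with ∈-map⁻ (palette φ) (∈-deduplicate⁻ (VecP.≡-dec BoolP._≟_) (List.map (palette φ) (allFin (n G))) z∈)
  ... | v , _ , refl = all∈K v

-- Let G be (3s, 3r)-biregular with bipartition (X, Y), where
-- s = s' + 1 and r = s + t.
--  * Split the 3s edges at each x ∈ X into s triples and the 3r edges at each
--    y ∈ Y into r triples.  The multigraph H whose vertices are these triples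
--    is 3-regular, so König gives each edge a class in Fin 3, every triple
--    seeing each class once.
--  * Form a multigraph B on the copies (v, κ), κ ∈ Fin 3: an edge xy of class
--    1 joins (x,1) and (y,1), one of class κ ∈ {0,2} joins (y,κ) and (x,κ), and
--    t extra "dummy" edges join (x,1) and (x,0) for every x ∈ X.  B has maximum
--    degree r, so König gives each edge a label in Fin r.
--  * The colour of an edge of G is the pair (label, class) ∈ Fin r × Fin 3.
module Construction (G : Graph) (s' t : ℕ) (bireg : Biregular (3 * suc s') (3 * suc (s' + t)) G) where
  open Neighbourhoods G
  open Slots G
  open Multigraphs
  open König using (konig)
  open Counting using (injection-onto)

  s r : ℕ
  s = suc s'
  r = suc (s' + t)

  open Sides G (3 * s) (3 * r) bireg public

  -- Edges of G are coded as combine x y ∈ Fin (N * N) with x ∈ X.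
  xOf yOf : Fin (N * N) → Fin N
  xOf e = proj₁ (remQuot {N} N e)
  yOf e = proj₂ (remQuot {N} N e)

  xOf-combine : ∀ (x y : Fin N) → xOf (combine x y) ≡ x
  xOf-combine x y = cong proj₁ (remQuot-combine x y)

  yOf-combine : ∀ (x y : Fin N) → yOf (combine x y) ≡ y
  yOf-combine x y = cong proj₂ (remQuot-combine x y)

  edge-ext : ∀ e e' → xOf e ≡ xOf e' → yOf e ≡ yOf e' → e ≡ e'
  edge-ext e e' px py =
    trans (sym (combine-remQuot {N} N e)) (trans (cong₂ combine px py) (combine-remQuot {N} N e'))

  isEdge : EdgeSet (N * N)
  isEdge e = ⌊ T? (adj G (xOf e) (yOf e)) ×-dec (side (xOf e) BoolP.≟ false) ⌋

  edge-adj : ∀ e → T (isEdge e) → T (adj G (xOf e) (yOf e))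
  edge-adj e t = proj₁ (toWitness t)

  edge-adj′ : ∀ e → T (isEdge e) → T (adj G (yOf e) (xOf e))
  edge-adj′ e t = adj-sym _ _ (edge-adj e t)

  edge-X : ∀ e → T (isEdge e) → side (xOf e) ≡ false
  edge-X e t = proj₂ (toWitness t)

  edge-Y : ∀ e → T (isEdge e) → side (yOf e) ≡ true
  edge-Y e t = X-to-Y _ _ (edge-adj e t) (edge-X e t)

  edge-intro : ∀ x y → T (adj G x y) → side x ≡ false → T (isEdge (combine x y))
  edge-intro x y a sx = fromWitness
    ( subst₂ (λ u w → T (adj G u w)) (sym (xOf-combine x y)) (sym (yOf-combine x y)) a
    , trans (cong side (xOf-combine x y)) sx )

  -- The multigraph H: the edge e lies in triple groupX e at its X-endpoint and
  -- in triple groupY e at its Y-endpoint.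
  slotX : Fin (N * N) → Fin s × Fin 3
  slotX e = slot s' (xOf e) (yOf e)

  slotY : Fin (N * N) → Fin r × Fin 3
  slotY e = slot (s' + t) (yOf e) (xOf e)

  groupX : Fin (N * N) → Fin s
  groupX e = proj₁ (slotX e)

  groupY : Fin (N * N) → Fin r
  groupY e = proj₁ (slotY e)

  leftH : Fin (N * N) → Fin (N * s)
  leftH e = combine (xOf e) (groupX e)

  rightH : Fin (N * N) → Fin (N * r)
  rightH e = combine (yOf e) (groupY e)

  slotX-determines : ∀ e e' → T (isEdge e) → T (isEdge e') → xOf e ≡ xOf e' → slotX e ≡ slotX e' → e ≡ e'
  slotX-determines e e' a a' px q = edge-ext e e' px
    (slot-inj s' (xOf e') (yOf e) (yOf e') (subst (λ z → T (adj G z (yOf e))) px (edge-adj e a)) (edge-adj e' a')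
              (degX (xOf e') (edge-X e' a')) (subst (λ z → slot s' z (yOf e) ≡ slotX e') px q))

  slotY-determines : ∀ e e' → T (isEdge e) → T (isEdge e') → yOf e ≡ yOf e' → slotY e ≡ slotY e' → e ≡ e'
  slotY-determines e e' a a' py q = edge-ext e e'
    (slot-inj (s' + t) (yOf e') (xOf e) (xOf e') (subst (λ z → T (adj G z (xOf e))) py (edge-adj′ e a)) (edge-adj′ e' a')
              (degY (yOf e') (edge-Y e' a')) (subst (λ z → slot (s' + t) z (xOf e) ≡ slotY e') py q)) py

  -- H has maximum degree 3: edges at one triple are told apart by their place
  H-degL : MaxDegree 3 leftH isEdge
  H-degL = MaxDegree-by-labels leftH isEdge (λ e → proj₂ (slotX e)) λ e e' a a' same place →
    let parts = combine-injective (xOf e) (groupX e) (xOf e') (groupX e') same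
    in slotX-determines e e' a a' (proj₁ parts) (cong₂ _,_ (proj₂ parts) place)

  H-degR : MaxDegree 3 rightH isEdge
  H-degR = MaxDegree-by-labels rightH isEdge (λ e → proj₂ (slotY e)) λ e e' a a' same place →
    let parts = combine-injective (yOf e) (groupY e) (yOf e') (groupY e') same
    in slotY-determines e e' a a' (proj₁ parts) (cong₂ _,_ (proj₂ parts) place)

  abstract
    H-colouring : Σ (Fin (N * N) → Fin 3) (ProperOn leftH rightH isEdge)
    H-colouring = konig 2 leftH rightH isEdge H-degL H-degR

  class : Fin (N * N) → Fin 3
  class = proj₁ H-colouring

  class-separatesL : ∀ e e' → T (isEdge e) → T (isEdge e') → leftH e ≡ leftH e' → class e ≡ class e' → e ≡ e'
  class-separatesL e e' a a' l q with e ≟ e'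
  ... | yes eq = eq
  ... | no ne = ⊥-elim (proj₂ H-colouring e e' ne a a' (inj₁ l) q)

  class-separatesR : ∀ e e' → T (isEdge e) → T (isEdge e') → rightH e ≡ rightH e' → class e ≡ class e' → e ≡ e'
  class-separatesR e e' a a' l q with e ≟ e'
  ... | yes eq = eq
  ... | no ne = ⊥-elim (proj₂ H-colouring e e' ne a a' (inj₂ l) q)

  triple-has-class : ∀ x → side x ≡ false → ∀ (i : Fin s) (κ : Fin 3) →
    ∃ λ e → T (isEdge e) × xOf e ≡ x × groupX e ≡ i × class e ≡ κ
  triple-has-class x sx i κ = witness (injection-onto (λ σ → class (edgeAt σ)) classAt-inj ℕP.≤-refl κ)
    where
    member : ∀ σ → ∃ λ y → T (adj G x y) × slot s' x y ≡ (i , σ)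
    member σ = slot-onto s' x (degX x sx) (i , σ)
    edgeAt : Fin 3 → Fin (N * N)
    edgeAt σ = combine x (proj₁ (member σ))
    edgeAt-edge : ∀ σ → T (isEdge (edgeAt σ))
    edgeAt-edge σ = edge-intro x _ (proj₁ (proj₂ (member σ))) sx
    edgeAt-slot : ∀ σ → slotX (edgeAt σ) ≡ (i , σ)
    edgeAt-slot σ = subst₂ (λ u w → slot s' u w ≡ (i , σ)) (sym (xOf-combine x _)) (sym (yOf-combine x _))
                           (proj₂ (proj₂ (member σ)))
    classAt-inj : Inj (λ σ → class (edgeAt σ))
    classAt-inj {σ} {σ'} eq = cong proj₂ (begin
      (i , σ)              ≡⟨ edgeAt-slot σ ⟨
      slotX (edgeAt σ)     ≡⟨ cong slotX (class-separatesL _ _ (edgeAt-edge σ) (edgeAt-edge σ') sameTriple eq) ⟩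
      slotX (edgeAt σ')    ≡⟨ edgeAt-slot σ' ⟩
      (i , σ')             ∎)
      where
      open ≡-Reasoning
      sameTriple : leftH (edgeAt σ) ≡ leftH (edgeAt σ')
      sameTriple = cong₂ combine (trans (xOf-combine x _) (sym (xOf-combine x _)))
                                 (trans (cong proj₁ (edgeAt-slot σ)) (sym (cong proj₁ (edgeAt-slot σ'))))
    witness : (∃ λ σ → class (edgeAt σ) ≡ κ) → ∃ λ e → T (isEdge e) × xOf e ≡ x × groupX e ≡ i × class e ≡ κ
    witness (σ , eq) = edgeAt σ , edgeAt-edge σ , xOf-combine x _ , cong proj₁ (edgeAt-slot σ) , eq

  -- The multigraph B on the copies combine v κ ∈ Fin (N * 3); its edge slots
  -- are the edges of G and the dummy edges combine x τ ∈ Fin (N * t).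
  leftCopy rightCopy : Fin 3 → Fin N → Fin N → Fin N
  leftCopy (suc zero) x y = x
  leftCopy zero x y = y
  leftCopy (suc (suc zero)) x y = y
  rightCopy (suc zero) x y = y
  rightCopy zero x y = x
  rightCopy (suc (suc zero)) x y = x

  dummyX : Fin (N * t) → Fin N
  dummyX d = proj₁ (remQuot {N} t d)

  dummyIndex : Fin (N * t) → Fin t
  dummyIndex d = proj₂ (remQuot {N} t d)

  dummy-ext : ∀ d d' → dummyX d ≡ dummyX d' → dummyIndex d ≡ dummyIndex d' → d ≡ d'
  dummy-ext d d' p q = trans (sym (combine-remQuot {N} t d)) (trans (cong₂ combine p q) (combine-remQuot {N} t d'))

  BEdge : Set
  BEdge = Fin (N * N) ⊎ Fin (N * t)

  leftB′ rightB′ : BEdge → Fin (N * 3)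
  leftB′ (inj₁ e) = combine (leftCopy (class e) (xOf e) (yOf e)) (class e)
  leftB′ (inj₂ d) = combine (dummyX d) (suc zero)
  rightB′ (inj₁ e) = combine (rightCopy (class e) (xOf e) (yOf e)) (class e)
  rightB′ (inj₂ d) = combine (dummyX d) zero

  isBEdge′ : BEdge → Bool
  isBEdge′ (inj₁ e) = isEdge e
  isBEdge′ (inj₂ d) = not (side (dummyX d))

  -- Labels in Fin r = Fin (s + t) separating the edges at a copy: the group at
  -- x (below s), the dummy index (above s), or the group at y.
  sepL′ sepR′ : Fin 3 → Fin (N * N) → Fin r
  sepL′ (suc zero) e = groupX e ↑ˡ t
  sepL′ zero e = groupY e
  sepL′ (suc (suc zero)) e = groupY e
  sepR′ (suc zero) e = groupY e
  sepR′ zero e = groupX e ↑ˡ t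
  sepR′ (suc (suc zero)) e = groupX e ↑ˡ t

  sepL sepR : BEdge → Fin r
  sepL (inj₁ e) = sepL′ (class e) e
  sepL (inj₂ d) = s ↑ʳ dummyIndex d
  sepR (inj₁ e) = sepR′ (class e) e
  sepR (inj₂ d) = s ↑ʳ dummyIndex d

  ↑ˡ≢↑ʳ : ∀ {a b} (i : Fin a) (j : Fin b) → i ↑ˡ b ≢ a ↑ʳ j
  ↑ˡ≢↑ʳ {a} {b} i j eq with trans (sym (splitAt-↑ˡ a i b)) (trans (cong (splitAt a) eq) (splitAt-↑ʳ a b j))
  ... | ()

  sepL′-separates : ∀ κ e e' → T (isEdge e) → T (isEdge e') → class e ≡ κ → class e' ≡ κ →
    leftCopy κ (xOf e) (yOf e) ≡ leftCopy κ (xOf e') (yOf e') → sepL′ κ e ≡ sepL′ κ e' → e ≡ e'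
  sepL′-separates (suc zero) e e' a a' ce ce' v g =
    class-separatesL e e' a a' (cong₂ combine v (↑ˡ-injective t _ _ g)) (trans ce (sym ce'))
  sepL′-separates zero e e' a a' ce ce' v g = class-separatesR e e' a a' (cong₂ combine v g) (trans ce (sym ce'))
  sepL′-separates (suc (suc zero)) e e' a a' ce ce' v g = class-separatesR e e' a a' (cong₂ combine v g) (trans ce (sym ce'))

  sepR′-separates : ∀ κ e e' → T (isEdge e) → T (isEdge e') → class e ≡ κ → class e' ≡ κ →
    rightCopy κ (xOf e) (yOf e) ≡ rightCopy κ (xOf e') (yOf e') → sepR′ κ e ≡ sepR′ κ e' → e ≡ e'
  sepR′-separates (suc zero) e e' a a' ce ce' v g = class-separatesR e e' a a' (cong₂ combine v g) (trans ce (sym ce'))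
  sepR′-separates zero e e' a a' ce ce' v g =
    class-separatesL e e' a a' (cong₂ combine v (↑ˡ-injective t _ _ g)) (trans ce (sym ce'))
  sepR′-separates (suc (suc zero)) e e' a a' ce ce' v g =
    class-separatesL e e' a a' (cong₂ combine v (↑ˡ-injective t _ _ g)) (trans ce (sym ce'))

  dummy-apartL : ∀ e d → class e ≡ suc zero → sepL′ (class e) e ≢ s ↑ʳ dummyIndex d
  dummy-apartL e d ce rewrite ce = ↑ˡ≢↑ʳ _ _

  dummy-apartR : ∀ e d → class e ≡ zero → sepR′ (class e) e ≢ s ↑ʳ dummyIndex d
  dummy-apartR e d ce rewrite ce = ↑ˡ≢↑ʳ _ _

  sepL-separates : ∀ b b' → T (isBEdge′ b) → T (isBEdge′ b') → leftB′ b ≡ leftB′ b' → sepL b ≡ sepL b' → b ≡ b'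
  sepL-separates (inj₁ e) (inj₁ e') a a' l g =
    let (sameCopy , sameClass) = combine-injective _ (class e) _ (class e') l
    in cong inj₁ (sepL′-separates (class e) e e' a a' refl (sym sameClass)
         (trans sameCopy (cong (λ κ → leftCopy κ (xOf e') (yOf e')) (sym sameClass)))
         (trans g (cong (λ κ → sepL′ κ e') (sym sameClass))))
  sepL-separates (inj₁ e) (inj₂ d) a a' l g =
    ⊥-elim (dummy-apartL e d (proj₂ (combine-injective _ (class e) (dummyX d) (suc zero) l)) g)
  sepL-separates (inj₂ d) (inj₁ e) a a' l g =
    ⊥-elim (dummy-apartL e d (proj₂ (combine-injective _ (class e) (dummyX d) (suc zero) (sym l))) (sym g))
  sepL-separates (inj₂ d) (inj₂ d') a a' l g =
    cong inj₂ (dummy-ext d d' (proj₁ (combine-injective (dummyX d) (suc zero) (dummyX d') (suc zero) l)) (↑ʳ-injective s _ _ g))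

  sepR-separates : ∀ b b' → T (isBEdge′ b) → T (isBEdge′ b') → rightB′ b ≡ rightB′ b' → sepR b ≡ sepR b' → b ≡ b'
  sepR-separates (inj₁ e) (inj₁ e') a a' l g =
    let (sameCopy , sameClass) = combine-injective _ (class e) _ (class e') l
    in cong inj₁ (sepR′-separates (class e) e e' a a' refl (sym sameClass)
         (trans sameCopy (cong (λ κ → rightCopy κ (xOf e') (yOf e')) (sym sameClass)))
         (trans g (cong (λ κ → sepR′ κ e') (sym sameClass))))
  sepR-separates (inj₁ e) (inj₂ d) a a' l g =
    ⊥-elim (dummy-apartR e d (proj₂ (combine-injective _ (class e) (dummyX d) zero l)) g)
  sepR-separates (inj₂ d) (inj₁ e) a a' l g =
    ⊥-elim (dummy-apartR e d (proj₂ (combine-injective _ (class e) (dummyX d) zero (sym l))) (sym g))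
  sepR-separates (inj₂ d) (inj₂ d') a a' l g =
    cong inj₂ (dummy-ext d d' (proj₁ (combine-injective (dummyX d) zero (dummyX d') zero l)) (↑ʳ-injective s _ _ g))

  toBEdge : Fin (N * N + N * t) → BEdge
  toBEdge = splitAt (N * N)

  toBEdge-inj : Inj toBEdge
  toBEdge-inj {b} {b'} eq = trans (sym (join-splitAt (N * N) (N * t) b))
                                  (trans (cong (join (N * N) (N * t)) eq) (join-splitAt (N * N) (N * t) b'))

  leftB rightB : Fin (N * N + N * t) → Fin (N * 3)
  leftB b = leftB′ (toBEdge b)
  rightB b = rightB′ (toBEdge b)

  isBEdge : EdgeSet (N * N + N * t)
  isBEdge b = isBEdge′ (toBEdge b)

  B-degL : MaxDegree r leftB isBEdge
  B-degL = MaxDegree-by-labels leftB isBEdge (λ b → sepL (toBEdge b)) λ b b' a a' l g →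
    toBEdge-inj (sepL-separates (toBEdge b) (toBEdge b') a a' l g)

  B-degR : MaxDegree r rightB isBEdge
  B-degR = MaxDegree-by-labels rightB isBEdge (λ b → sepR (toBEdge b)) λ b b' a a' l g →
    toBEdge-inj (sepR-separates (toBEdge b) (toBEdge b') a a' l g)

  abstract
    B-colouring : Σ (Fin (N * N + N * t) → Fin r) (ProperOn leftB rightB isBEdge)
    B-colouring = konig (s' + t) leftB rightB isBEdge B-degL B-degR

  labelB : BEdge → Fin r
  labelB u = proj₁ B-colouring (join (N * N) (N * t) u)

  labelB-proper : ∀ u u' → u ≢ u' → T (isBEdge′ u) → T (isBEdge′ u') →
    (leftB′ u ≡ leftB′ u' ⊎ rightB′ u ≡ rightB′ u') → labelB u ≢ labelB u'
  labelB-proper u u' u≢u' a a' adj = proj₂ B-colouring (join (N * N) (N * t) u) (join (N * N) (N * t) u')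
    (λ eq → u≢u' (trans (sym (back u)) (trans (cong toBEdge eq) (back u'))))
    (subst (λ z → T (isBEdge′ z)) (sym (back u)) a)
    (subst (λ z → T (isBEdge′ z)) (sym (back u')) a')
    (subst₂ (λ z z' → leftB′ z ≡ leftB′ z' ⊎ rightB′ z ≡ rightB′ z') (sym (back u)) (sym (back u')) adj)
    where
    back : ∀ u → toBEdge (join (N * N) (N * t) u) ≡ u
    back = splitAt-join (N * N) (N * t)

  label : Fin (N * N) → Fin r
  label e = labelB (inj₁ e)

  dummyLabel : Fin (N * t) → Fin r
  dummyLabel d = labelB (inj₂ d)

  colourOf : Fin (N * N) → Fin (r * 3)
  colourOf e = combine (label e) (class e)

  codeBySide : Bool → Fin N → Fin N → Fin (N * N)
  codeBySide false u v = combine u v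
  codeBySide true u v = combine v u

  edgeCode : Fin N → Fin N → Fin (N * N)
  edgeCode u v = codeBySide (side u) u v

  edgeCode-X : ∀ u v → side u ≡ false → edgeCode u v ≡ combine u v
  edgeCode-X u v su rewrite su = refl

  edgeCode-Y : ∀ u v → side u ≡ true → edgeCode u v ≡ combine v u
  edgeCode-Y u v su rewrite su = refl

  edgeCode-sym : ∀ u v → adj G u v ≡ true → edgeCode u v ≡ edgeCode v u
  edgeCode-sym u v a with side u in su | side v in sv
  ... | false | true = refl
  ... | true | false = refl
  ... | false | false = ⊥-elim (cross u v a (trans su (sym sv)))
  ... | true | true = ⊥-elim (cross u v a (trans su (sym sv)))

  φ : EdgeColouring G (r * 3)
  φ = record { col = λ u v → colourOf (edgeCode u v) ; colSym = λ u v a → cong colourOf (edgeCode-sym u v a) }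

  edgeCode-at-X : ∀ u v → T (adj G u v) → side u ≡ false →
    T (isEdge (edgeCode u v)) × xOf (edgeCode u v) ≡ u × yOf (edgeCode u v) ≡ v
  edgeCode-at-X u v a su rewrite edgeCode-X u v su = edge-intro u v a su , xOf-combine u v , yOf-combine u v

  edgeCode-at-Y : ∀ u v → T (adj G u v) → side u ≡ true →
    T (isEdge (edgeCode u v)) × yOf (edgeCode u v) ≡ u × xOf (edgeCode u v) ≡ v
  edgeCode-at-Y u v a su rewrite edgeCode-Y u v su =
    edge-intro v u (adj-sym u v a) (Y-to-X u v a su) , yOf-combine v u , xOf-combine v u

  BAdjacent : Fin (N * N) → Fin (N * N) → Set
  BAdjacent e e' = leftB′ (inj₁ e) ≡ leftB′ (inj₁ e') ⊎ rightB′ (inj₁ e) ≡ rightB′ (inj₁ e')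

  same-class-at-X : ∀ e e' → xOf e ≡ xOf e' → class e ≡ class e' → BAdjacent e e'
  same-class-at-X e e' px same = meet (class e) (class e') same
    where
    meet : ∀ κ κ' → κ ≡ κ' → combine (leftCopy κ (xOf e) (yOf e)) κ ≡ combine (leftCopy κ' (xOf e') (yOf e')) κ'
                            ⊎ combine (rightCopy κ (xOf e) (yOf e)) κ ≡ combine (rightCopy κ' (xOf e') (yOf e')) κ'
    meet (suc zero) .(suc zero) refl = inj₁ (cong₂ combine px refl)
    meet zero .zero refl = inj₂ (cong₂ combine px refl)
    meet (suc (suc zero)) .(suc (suc zero)) refl = inj₂ (cong₂ combine px refl)

  same-class-at-Y : ∀ e e' → yOf e ≡ yOf e' → class e ≡ class e' → BAdjacent e e'
  same-class-at-Y e e' py same = meet (class e) (class e') same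
    where
    meet : ∀ κ κ' → κ ≡ κ' → combine (leftCopy κ (xOf e) (yOf e)) κ ≡ combine (leftCopy κ' (xOf e') (yOf e')) κ'
                            ⊎ combine (rightCopy κ (xOf e) (yOf e)) κ ≡ combine (rightCopy κ' (xOf e') (yOf e')) κ'
    meet (suc zero) .(suc zero) refl = inj₂ (cong₂ combine py refl)
    meet zero .zero refl = inj₁ (cong₂ combine py refl)
    meet (suc (suc zero)) .(suc (suc zero)) refl = inj₁ (cong₂ combine py refl)

  colourOf-≢ : ∀ e e' → e ≢ e' → T (isEdge e) → T (isEdge e') → BAdjacent e e' → colourOf e ≢ colourOf e'
  colourOf-≢ e e' e≢e' a a' adj eq = labelB-proper (inj₁ e) (inj₁ e') (λ x → e≢e' (inj₁-injective x)) a a' adj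
                                       (proj₁ (combine-injective (label e) (class e) (label e') (class e') eq))

  φ-proper : Proper φ
  φ-proper u v w a₁ a₂ v≢w eq = by-side (side u) refl
    where
    sameClass : class (edgeCode u v) ≡ class (edgeCode u w)
    sameClass = proj₂ (combine-injective (label _) (class _) (label _) (class _) eq)
    by-side : ∀ b → side u ≡ b → ⊥
    by-side false su =
      let (e , x , y) = edgeCode-at-X u v (from BoolP.T-≡ a₁) su ; (e' , x' , y') = edgeCode-at-X u w (from BoolP.T-≡ a₂) su
      in colourOf-≢ _ _ (λ z → v≢w (trans (sym y) (trans (cong yOf z) y'))) e e'
                    (same-class-at-X _ _ (trans x (sym x')) sameClass) eq
    by-side true su =
      let (e , y , x) = edgeCode-at-Y u v (from BoolP.T-≡ a₁) su ; (e' , y' , x') = edgeCode-at-Y u w (from BoolP.T-≡ a₂) su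
      in colourOf-≢ _ _ (λ z → v≢w (trans (sym x) (trans (cong xOf z) x'))) e e'
                    (same-class-at-Y _ _ (trans y (sym y')) sameClass) eq

  open Palettes φ

  -- a vertex of Y sees all 3r colours, as its 3r edges have distinct colours
  Y-palette-full : ∀ y → side y ≡ true → ∀ c → InPalette y c
  Y-palette-full y sy c = hit (injection-onto colourAt colourAt-inj (ℕP.≤-reflexive (ℕP.*-comm r 3)) c)
    where
    open Enumerate y (degY y sy)
    colourAt : Fin (3 * r) → Fin (r * 3)
    colourAt p = col φ y (nbr p)
    colourAt-inj : Inj colourAt
    colourAt-inj {p} {p'} eq with p ≟ p'
    ... | yes same = same
    ... | no differ = ⊥-elim (φ-proper y (nbr p) (nbr p') (to BoolP.T-≡ (nbr-adj p)) (to BoolP.T-≡ (nbr-adj p'))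
                                       (λ z → differ (nbr-inj z)) eq)
    hit : (∃ λ p → colourAt p ≡ c) → InPalette y c
    hit (p , eq) = palette-∋ y (nbr p) c (nbr-adj p) eq

  -- The palette of x ∈ X: for each class κ, the labels of the class-κ edges
  -- of the s triples at x.  The labels of classes 0 and 1 avoid the labels of
  -- the t dummy edges at x, which share a copy of x with them in B.
  module AtX (x : Fin N) (sx : side x ≡ false) where

    edgeIn : Fin s → Fin 3 → Fin (N * N)
    edgeIn i κ = proj₁ (triple-has-class x sx i κ)

    edgeIn-edge : ∀ i κ → T (isEdge (edgeIn i κ))
    edgeIn-edge i κ = proj₁ (proj₂ (triple-has-class x sx i κ))

    edgeIn-x : ∀ i κ → xOf (edgeIn i κ) ≡ x
    edgeIn-x i κ = proj₁ (proj₂ (proj₂ (triple-has-class x sx i κ)))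

    edgeIn-group : ∀ i κ → groupX (edgeIn i κ) ≡ i
    edgeIn-group i κ = proj₁ (proj₂ (proj₂ (proj₂ (triple-has-class x sx i κ))))

    edgeIn-class : ∀ i κ → class (edgeIn i κ) ≡ κ
    edgeIn-class i κ = proj₂ (proj₂ (proj₂ (proj₂ (triple-has-class x sx i κ))))

    groupLabel : Fin 3 → Fin s → Fin r
    groupLabel κ i = label (edgeIn i κ)

    -- the class-κ edges at x pairwise meet in B
    groupLabel-inj : ∀ κ → Inj (groupLabel κ)
    groupLabel-inj κ {i} {i'} eq = by-cases (edgeIn i κ ≟ edgeIn i' κ)
      where
      by-cases : Dec (edgeIn i κ ≡ edgeIn i' κ) → i ≡ i'
      by-cases (yes same) = trans (sym (edgeIn-group i κ)) (trans (cong groupX same) (edgeIn-group i' κ))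
      by-cases (no differ) = ⊥-elim (labelB-proper (inj₁ (edgeIn i κ)) (inj₁ (edgeIn i' κ)) (λ z → differ (inj₁-injective z))
        (edgeIn-edge i κ) (edgeIn-edge i' κ)
        (same-class-at-X _ _ (trans (edgeIn-x i κ) (sym (edgeIn-x i' κ))) (trans (edgeIn-class i κ) (sym (edgeIn-class i' κ))))
        eq)

    dummyAt : Fin t → Fin (N * t)
    dummyAt τ = combine x τ

    dummyAt-x : ∀ τ → dummyX (dummyAt τ) ≡ x
    dummyAt-x τ = cong proj₁ (remQuot-combine x τ)

    dummyAt-edge : ∀ τ → T (isBEdge′ (inj₂ (dummyAt τ)))
    dummyAt-edge τ = subst (λ z → T (not z)) (sym (trans (cong side (dummyAt-x τ)) sx)) tt

    dummyLabelAt : Fin t → Fin r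
    dummyLabelAt τ = dummyLabel (dummyAt τ)

    dummyLabelAt-inj : Inj dummyLabelAt
    dummyLabelAt-inj {τ} {τ'} eq with τ ≟ τ'
    ... | yes same = same
    ... | no differ = ⊥-elim (labelB-proper (inj₂ (dummyAt τ)) (inj₂ (dummyAt τ'))
                                (λ z → differ (proj₂ (combine-injective x τ x τ' (inj₂-injective z))))
                                (dummyAt-edge τ) (dummyAt-edge τ')
                                (inj₁ (cong (λ z → combine z (suc zero)) (trans (dummyAt-x τ) (sym (dummyAt-x τ'))))) eq)

    -- class-0 edges meet the dummies at (x,0), class-1 edges at (x,1)
    class01-avoids-dummies : ∀ κ → (κ ≡ zero ⊎ κ ≡ suc zero) → ∀ i τ → groupLabel κ i ≢ dummyLabelAt τ
    class01-avoids-dummies κ κ01 i τ eq =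
      labelB-proper (inj₁ (edgeIn i κ)) (inj₂ (dummyAt τ)) (λ ()) (edgeIn-edge i κ) (dummyAt-edge τ) (meet κ01) eq
      where
      meet : (κ ≡ zero ⊎ κ ≡ suc zero) →
        leftB′ (inj₁ (edgeIn i κ)) ≡ leftB′ (inj₂ (dummyAt τ)) ⊎ rightB′ (inj₁ (edgeIn i κ)) ≡ rightB′ (inj₂ (dummyAt τ))
      meet (inj₁ refl) = inj₂ (at-copy (class (edgeIn i zero)) (edgeIn-class i zero))
        where
        at-copy : ∀ κ' → κ' ≡ zero →
          combine (rightCopy κ' (xOf (edgeIn i zero)) (yOf (edgeIn i zero))) κ' ≡ combine (dummyX (dummyAt τ)) zero
        at-copy .zero refl = cong₂ combine (trans (edgeIn-x i zero) (sym (dummyAt-x τ))) refl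
      meet (inj₂ refl) = inj₁ (at-copy (class (edgeIn i (suc zero))) (edgeIn-class i (suc zero)))
        where
        at-copy : ∀ κ' → κ' ≡ suc zero →
          combine (leftCopy κ' (xOf (edgeIn i (suc zero))) (yOf (edgeIn i (suc zero)))) κ' ≡ combine (dummyX (dummyAt τ)) (suc zero)
        at-copy .(suc zero) refl = cong₂ combine (trans (edgeIn-x i (suc zero)) (sym (dummyAt-x τ))) refl

    palette-X⁺ : ∀ j κ i → groupLabel κ i ≡ j → InPalette x (combine j κ)
    palette-X⁺ j κ i eq = palette-∋ x y (combine j κ) xy colour-eq
      where
      e = edgeIn i κ
      y = yOf e
      xy : T (adj G x y)
      xy = subst (λ z → T (adj G z y)) (edgeIn-x i κ) (edge-adj e (edgeIn-edge i κ))
      code-eq : edgeCode x y ≡ e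
      code-eq = trans (edgeCode-X x y sx) (edge-ext (combine x y) e (trans (xOf-combine x y) (sym (edgeIn-x i κ))) (yOf-combine x y))
      colour-eq : col φ x y ≡ combine j κ
      colour-eq = trans (cong colourOf code-eq) (cong₂ combine eq (edgeIn-class i κ))

    palette-X⁻ : ∀ j κ → InPalette x (combine j κ) → ∃ λ i → groupLabel κ i ≡ j
    palette-X⁻ j κ inP = groupX e , trans (cong label same) sameLabel
      where
      witness = palette-witness x (combine j κ) inP
      u = proj₁ witness
      e = edgeCode x u
      atX = edgeCode-at-X x u (proj₁ (proj₂ witness)) sx
      parts = combine-injective (label e) (class e) j κ (proj₂ (proj₂ witness))
      sameLabel = proj₁ parts
      same : edgeIn (groupX e) κ ≡ e
      same = class-separatesL (edgeIn (groupX e) κ) e (edgeIn-edge (groupX e) κ) (proj₁ atX)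
               (cong₂ combine (trans (edgeIn-x (groupX e) κ) (sym (proj₁ (proj₂ atX)))) (edgeIn-group (groupX e) κ))
               (trans (edgeIn-class (groupX e) κ) (sym (proj₂ parts)))

-- Counting palettes.  A palette in Fin (r * 3) = Fin r × Fin 3 is described by
-- two subsets of Fin r: the labels j with (j, 0), (j, 1) present, and those
-- with (j, 2) present.
module PaletteCounting where
  open Palettes

  byClass : Fin 3 → Bool → Bool → Bool
  byClass zero b₀₁ b₂ = b₀₁
  byClass (suc zero) b₀₁ b₂ = b₀₁
  byClass (suc (suc zero)) b₀₁ b₂ = b₂

  shape : ∀ {r} → (Fin r → Bool) → (Fin r → Bool) → Vec Bool (r * 3)
  shape {r} h₀₁ h₂ = tabulate λ c → let (j , κ) = remQuot {r} 3 c in byClass κ (h₀₁ j) (h₂ j)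

  shape-≡ : ∀ {r} (V : Vec Bool (r * 3)) (h₀₁ h₂ : Fin r → Bool) →
    (∀ j κ → lookup V (combine j κ) ≡ true → T (byClass κ (h₀₁ j) (h₂ j))) →
    (∀ j κ → T (byClass κ (h₀₁ j) (h₂ j)) → lookup V (combine j κ) ≡ true) → V ≡ shape h₀₁ h₂
  shape-≡ {r} V h₀₁ h₂ V⇒ ⇒V = trans (sym (VecP.tabulate∘lookup V)) (VecP.tabulate-cong entry)
    where
    bool-ext : ∀ {a b : Bool} → (a ≡ true → T b) → (T b → a ≡ true) → a ≡ b
    bool-ext {true} {true} _ _ = refl
    bool-ext {true} {false} a⇒b _ = ⊥-elim (a⇒b refl)
    bool-ext {false} {true} _ b⇒a = b⇒a tt
    bool-ext {false} {false} _ _ = refl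
    entry : ∀ c → lookup V c ≡ byClass (proj₂ (remQuot {r} 3 c)) (h₀₁ (proj₁ (remQuot {r} 3 c))) (h₂ (proj₁ (remQuot {r} 3 c)))
    entry c = trans (cong (lookup V) (sym (combine-remQuot {r} 3 c)))
                    (bool-ext (V⇒ (proj₁ (remQuot {r} 3 c)) (proj₂ (remQuot {r} 3 c)))
                              (⇒V (proj₁ (remQuot {r} 3 c)) (proj₂ (remQuot {r} 3 c))))

  few-palettes : ∀ {G : Graph} {r M : ℕ} (φ : EdgeColouring G M) (P : Fin r → Fin r → Vec Bool M) →
    (∀ v → (∀ c → InPalette φ v c) ⊎ (∃ λ a → ∃ λ b → palette φ v ≡ P a b)) → numPalettes φ ≤ r * r + 1
  few-palettes {G} {r} {M} φ P classify =
    subst (numPalettes φ ≤_) (ℕP.+-comm 1 (r * r)) (subst (λ n → numPalettes φ ≤ suc n) (ListP.length-tabulate pairP)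
      (numPalettes-≤ φ candidates candidate))
    where
    full : Vec Bool M
    full = tabulate λ _ → true
    pairP : Fin (r * r) → Vec Bool M
    pairP c = P (proj₁ (remQuot {r} r c)) (proj₂ (remQuot {r} r c))
    candidates : List (Vec Bool M)
    candidates = full ∷ List.tabulate pairP
    candidate : ∀ v → palette φ v ∈ candidates
    candidate v with classify v
    ... | inj₁ isFull = here (trans (sym (VecP.tabulate∘lookup _)) (VecP.tabulate-cong isFull))
    ... | inj₂ (a , b , eq) = there (subst (_∈ List.tabulate pairP)
      (trans (cong (λ ab → P (proj₁ ab) (proj₂ ab)) (remQuot-combine a b)) (sym eq)) (∈-tabulate⁺ (combine a b)))

module UpperBounds where
  open PaletteCounting
  open Palettes using (InPalette)
  open Counting using (jointly-onto; missed-value)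

  only-group : ∀ (i : Fin 1) → i ≡ zero
  only-group zero = refl

  -- (3, 3r)-biregular: one triple at each x ∈ X and t = r − 1 dummies.  Classes
  -- 0 and 1 at x both carry the one label a left free by the dummies, class 2
  -- some label b, so the palette of x is determined by (a, b).
  one-triple : ∀ {G} t → Biregular 3 (3 * suc t) G → PaletteIndex≤ G (suc t * suc t + 1)
  one-triple {G} t bireg = suc t * 3 , φ , φ-proper , few-palettes φ P classify
    where
    open Construction G 0 t bireg
    P : Fin r → Fin r → Vec Bool (r * 3)
    P a b = shape (λ j → ⌊ j ≟ a ⌋) (λ j → ⌊ j ≟ b ⌋)

    module PaletteX (x : Fin (n G)) (sx : side x ≡ false) where
      open AtX x sx
      a b : Fin r
      a = groupLabel zero zero
      b = groupLabel (suc (suc zero)) zero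

      -- the single class-0 label and the t dummy labels exhaust Fin r
      class1-label : groupLabel (suc zero) zero ≡ a
      class1-label = by-cover (jointly-onto (groupLabel zero) dummyLabelAt (groupLabel-inj zero) dummyLabelAt-inj
                                            (class01-avoids-dummies zero (inj₁ refl)) ℕP.≤-refl (groupLabel (suc zero) zero))
        where
        by-cover : (∃ λ i → groupLabel zero i ≡ groupLabel (suc zero) zero) ⊎ (∃ λ τ → dummyLabelAt τ ≡ groupLabel (suc zero) zero) →
          groupLabel (suc zero) zero ≡ a
        by-cover (inj₁ (i , eq)) = trans (sym eq) (cong (groupLabel zero) (only-group i))
        by-cover (inj₂ (τ , eq)) = ⊥-elim (class01-avoids-dummies (suc zero) (inj₂ refl) zero τ (sym eq))

      label-in-palette : ∀ j κ → InPalette φ x (combine j κ) → groupLabel κ zero ≡ j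
      label-in-palette j κ inP = let (i , eq) = palette-X⁻ j κ inP in trans (cong (groupLabel κ) (sym (only-group i))) eq

      palette-shape : palette φ x ≡ P a b
      palette-shape = shape-≡ (palette φ x) _ _ present⇒ ⇒present
        where
        present⇒ : ∀ j κ → InPalette φ x (combine j κ) → T (byClass κ ⌊ j ≟ a ⌋ ⌊ j ≟ b ⌋)
        present⇒ j zero inP = fromWitness (sym (label-in-palette j zero inP))
        present⇒ j (suc zero) inP = fromWitness (trans (sym (label-in-palette j (suc zero) inP)) class1-label)
        present⇒ j (suc (suc zero)) inP = fromWitness (sym (label-in-palette j (suc (suc zero)) inP))
        ⇒present : ∀ j κ → T (byClass κ ⌊ j ≟ a ⌋ ⌊ j ≟ b ⌋) → InPalette φ x (combine j κ)
        ⇒present j zero h = palette-X⁺ j zero zero (sym (toWitness h))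
        ⇒present j (suc zero) h = palette-X⁺ j (suc zero) zero (trans class1-label (sym (toWitness h)))
        ⇒present j (suc (suc zero)) h = palette-X⁺ j (suc (suc zero)) zero (sym (toWitness h))

    classify : ∀ v → (∀ c → InPalette φ v c) ⊎ (∃ λ a → ∃ λ b → palette φ v ≡ P a b)
    classify v = by-side (side v) refl
      where
      by-side : ∀ b → side v ≡ b → (∀ c → InPalette φ v c) ⊎ (∃ λ a → ∃ λ b → palette φ v ≡ P a b)
      by-side false sv = inj₂ (_ , _ , PaletteX.palette-shape v sv)
      by-side true sv = inj₁ (Y-palette-full v sv)

  -- (3s, 3(s + 1))-biregular: s triples at each x ∈ X and one dummy.  Classes
  -- 0 and 1 at x carry every label except the dummy's label d, class 2 carries
  -- s of the s + 1 labels, all but some m, so the palette of x is determined by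
  -- (d, m).
  one-dummy : ∀ {G} s' → Biregular (3 * suc s') (3 * suc (s' + 1)) G → PaletteIndex≤ G (suc (s' + 1) * suc (s' + 1) + 1)
  one-dummy {G} s' bireg = suc (s' + 1) * 3 , φ , φ-proper , few-palettes φ P classify
    where
    open Construction G s' 1 bireg
    P : Fin r → Fin r → Vec Bool (r * 3)
    P d m = shape (λ j → not ⌊ j ≟ d ⌋) (λ j → not ⌊ j ≟ m ⌋)

    module PaletteX (x : Fin (n G)) (sx : side x ≡ false) where
      open AtX x sx
      d : Fin r
      d = dummyLabelAt zero

      missed : ∃ λ m → ∀ i → groupLabel (suc (suc zero)) i ≢ m
      missed = missed-value (groupLabel (suc (suc zero))) (groupLabel-inj (suc (suc zero)))
                            (ℕP.≤-reflexive (cong suc (ℕP.+-comm 1 s')))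

      m : Fin r
      m = proj₁ missed

      class01-hits : ∀ κ → (κ ≡ zero ⊎ κ ≡ suc zero) → ∀ j → j ≢ d → ∃ λ i → groupLabel κ i ≡ j
      class01-hits κ κ01 j j≢d = by-cover (jointly-onto (groupLabel κ) dummyLabelAt (groupLabel-inj κ) dummyLabelAt-inj
                                                        (class01-avoids-dummies κ κ01) ℕP.≤-refl j)
        where
        by-cover : (∃ λ i → groupLabel κ i ≡ j) ⊎ (∃ λ τ → dummyLabelAt τ ≡ j) → ∃ λ i → groupLabel κ i ≡ j
        by-cover (inj₁ hit) = hit
        by-cover (inj₂ (τ , eq)) = ⊥-elim (j≢d (trans (sym eq) (cong dummyLabelAt (only-group τ))))

      class2-hits : ∀ j → j ≢ m → ∃ λ i → groupLabel (suc (suc zero)) i ≡ j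
      class2-hits j j≢m = by-cover (jointly-onto (groupLabel (suc (suc zero))) (λ (_ : Fin 1) → m) (groupLabel-inj (suc (suc zero)))
                                                 (λ {τ} {τ'} _ → trans (only-group τ) (sym (only-group τ')))
                                                 (λ i _ → proj₂ missed i) ℕP.≤-refl j)
        where
        by-cover : (∃ λ i → groupLabel (suc (suc zero)) i ≡ j) ⊎ (∃ λ (_ : Fin 1) → m ≡ j) → ∃ λ i → groupLabel (suc (suc zero)) i ≡ j
        by-cover (inj₁ hit) = hit
        by-cover (inj₂ (_ , eq)) = ⊥-elim (j≢m (sym eq))

      palette-shape : palette φ x ≡ P d m
      palette-shape = shape-≡ (palette φ x) _ _ present⇒ ⇒present
        where
        present⇒ : ∀ j κ → InPalette φ x (combine j κ) → T (byClass κ (not ⌊ j ≟ d ⌋) (not ⌊ j ≟ m ⌋))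
        present⇒ j zero inP = let (i , eq) = palette-X⁻ j zero inP in
          fromWitnessFalse (λ j≡d → class01-avoids-dummies zero (inj₁ refl) i zero (trans eq j≡d))
        present⇒ j (suc zero) inP = let (i , eq) = palette-X⁻ j (suc zero) inP in
          fromWitnessFalse (λ j≡d → class01-avoids-dummies (suc zero) (inj₂ refl) i zero (trans eq j≡d))
        present⇒ j (suc (suc zero)) inP = let (i , eq) = palette-X⁻ j (suc (suc zero)) inP in
          fromWitnessFalse (λ j≡m → proj₂ missed i (trans eq j≡m))
        ⇒present : ∀ j κ → T (byClass κ (not ⌊ j ≟ d ⌋) (not ⌊ j ≟ m ⌋)) → InPalette φ x (combine j κ)
        ⇒present j zero h = let (i , eq) = class01-hits zero (inj₁ refl) j (toWitnessFalse h) in palette-X⁺ j zero i eq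
        ⇒present j (suc zero) h = let (i , eq) = class01-hits (suc zero) (inj₂ refl) j (toWitnessFalse h) in palette-X⁺ j (suc zero) i eq
        ⇒present j (suc (suc zero)) h = let (i , eq) = class2-hits j (toWitnessFalse h) in palette-X⁺ j (suc (suc zero)) i eq

    classify : ∀ v → (∀ c → InPalette φ v c) ⊎ (∃ λ a → ∃ λ b → palette φ v ≡ P a b)
    classify v = by-side (side v) refl
      where
      by-side : ∀ b → side v ≡ b → (∀ c → InPalette φ v c) ⊎ (∃ λ a → ∃ λ b → palette φ v ≡ P a b)
      by-side false sv = inj₂ (_ , _ , PaletteX.palette-shape v sv)
      by-side true sv = inj₁ (Y-palette-full v sv)

-- Lower bound for (3, 3r)-biregular graphs, r ≥ 2: fix y ∈ Y.  Its 3r edges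
-- have distinct colours, and each neighbour w of y has a palette of only 3
-- colours, which is therefore not the palette of y (3r > 3).  Recording for the
-- edge yw the index of the palette of w and the position of the colour of yw
-- among the 3 edges of a fixed representative neighbour with that palette is an
-- injection of Fin (3r) into (palettes other than y's) × Fin 3, so at least
-- r palettes occur besides the palette of y.
module LowerBound (G : Graph) (k : ℕ) (bireg : Biregular 3 (3 * suc (suc k)) G)
  {M : ℕ} (φ : EdgeColouring G M) (φ-proper : Proper φ) where
  open Neighbourhoods G
  open Palettes φ
  open Counting using (avoiding-triples-bound)

  r : ℕ
  r = suc (suc k)

  open Sides G 3 (3 * r) bireg

  distinct : List (Vec Bool M)
  distinct = deduplicate (VecP.≡-dec BoolP._≟_) (List.map (palette φ) (allFin N))

  palette∈distinct : ∀ v → palette φ v ∈ distinct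
  palette∈distinct v = ∈-deduplicate⁺ (VecP.≡-dec BoolP._≟_) (∈-map⁺ (palette φ) (∈-allFin v))

  paletteIndex : Fin N → Fin (length distinct)
  paletteIndex v = index (palette∈distinct v)

  paletteIndex-≡ : ∀ v v' → paletteIndex v ≡ paletteIndex v' → palette φ v ≡ palette φ v'
  paletteIndex-≡ v v' eq = begin
    palette φ v                                ≡⟨ lookup-index (palette∈distinct v) ⟩
    List.lookup distinct (paletteIndex v)      ≡⟨ cong (List.lookup distinct) eq ⟩
    List.lookup distinct (paletteIndex v')     ≡⟨ lookup-index (palette∈distinct v') ⟨
    palette φ v'                               ∎
    where open ≡-Reasoning

  module AroundY (y : Fin N) (sy : side y ≡ true) where
    open Enumerate y (degY y sy) using () renaming (nbr to w; nbr-adj to w-adj; nbr-inj to w-inj)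

    w-adj′ : ∀ p → T (adj G (w p) y)
    w-adj′ p = adj-sym y (w p) (w-adj p)

    w-X : ∀ p → side (w p) ≡ false
    w-X p = Y-to-X y (w p) (w-adj p) sy

    colourAt : Fin (3 * r) → Fin M
    colourAt p = col φ y (w p)

    colourAt-inj : Inj colourAt
    colourAt-inj {p} {p'} eq = by-cases (p ≟ p')
      where
      by-cases : Dec (p ≡ p') → p ≡ p'
      by-cases (yes same) = same
      by-cases (no differ) = ⊥-elim (φ-proper y (w p) (w p') (to BoolP.T-≡ (w-adj p)) (to BoolP.T-≡ (w-adj p'))
                                              (λ z → differ (w-inj z)) eq)

    colourAt-at-w : ∀ p → InPalette (w p) (colourAt p)
    colourAt-at-w p = palette-∋ (w p) y (colourAt p) (w-adj′ p) (colSym φ (w p) y (to BoolP.T-≡ (w-adj′ p)))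

    colourAt-at-y : ∀ q → InPalette y (colourAt q)
    colourAt-at-y q = palette-∋ y (w q) (colourAt q) (w-adj q) refl

    around-w : Fin (3 * r) → Fin 3 → Fin N
    around-w p σ = Enumerate.nbr (w p) (degX (w p) (w-X p)) σ

    colour-around-w : Fin (3 * r) → Fin 3 → Fin M
    colour-around-w p σ = col φ (w p) (around-w p σ)

    position-exists : ∀ p c → InPalette (w p) c → ∃ λ σ → colour-around-w p σ ≡ c
    position-exists p c inP = index-of u a , trans (cong (col φ (w p)) (nbr-index u a)) (proj₂ (proj₂ witness))
      where
      open Enumerate (w p) (degX (w p) (w-X p))
      witness = palette-witness (w p) c inP
      u = proj₁ witness
      a = proj₁ (proj₂ witness)

    position : Fin (3 * r) → Fin M → Fin 3
    position p c = choice zero (any? (λ σ → colour-around-w p σ ≟ c))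

    position-spec : ∀ p c → InPalette (w p) c → colour-around-w p (position p c) ≡ c
    position-spec p c inP = choice-spec zero (any? (λ σ → colour-around-w p σ ≟ c)) (position-exists p c inP)

    representative : Fin (length distinct) → Fin (3 * r)
    representative i = choice zero (any? (λ p → paletteIndex (w p) ≟ i))

    representative-palette : ∀ p → palette φ (w (representative (paletteIndex (w p)))) ≡ palette φ (w p)
    representative-palette p = paletteIndex-≡ _ (w p)
      (choice-spec zero (any? (λ p' → paletteIndex (w p') ≟ paletteIndex (w p))) (p , refl))

    rep : Fin (3 * r) → Fin (3 * r)
    rep p = representative (paletteIndex (w p))

    code : Fin (3 * r) → Fin (length distinct) × Fin 3
    code p = paletteIndex (w p) , position (rep p) (colourAt p)

    code-spec : ∀ p → colour-around-w (rep p) (proj₂ (code p)) ≡ colourAt p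
    code-spec p = position-spec (rep p) (colourAt p)
                    (trans (cong (λ V → lookup V (colourAt p)) (representative-palette p)) (colourAt-at-w p))

    code-inj : Inj code
    code-inj {p} {p'} eq = colourAt-inj (begin
      colourAt p                                                          ≡⟨ code-spec p ⟨
      colour-around-w (representative (proj₁ (code p))) (proj₂ (code p))     ≡⟨ cong (λ c → colour-around-w (representative (proj₁ c)) (proj₂ c)) eq ⟩
      colour-around-w (representative (proj₁ (code p'))) (proj₂ (code p'))   ≡⟨ code-spec p' ⟩
      colourAt p'                                                         ∎)
      where open ≡-Reasoning

    -- a neighbour of y has 3 colours, y has 3r ≥ 6
    other-palette : ∀ p → paletteIndex y ≢ paletteIndex (w p)
    other-palette p eq = ℕP.<-irrefl refl (ℕP.≤-trans 4≤3r (injective⇒≤ {f = λ q → position p (colourAt q)} position-inj))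
      where
      4≤3r : 4 ≤ 3 * r
      4≤3r = ℕP.≤-trans (ℕP.m≤m+n 4 2) (ℕP.*-monoʳ-≤ 3 (s≤s (s≤s z≤n)))
      same : palette φ (w p) ≡ palette φ y
      same = paletteIndex-≡ (w p) y (sym eq)
      position-inj : Inj (λ q → position p (colourAt q))
      position-inj {q} {q'} e = colourAt-inj (trans (sym (spec q)) (trans (cong (colour-around-w p) e) (spec q')))
        where
        spec : ∀ q → colour-around-w p (position p (colourAt q)) ≡ colourAt q
        spec q = position-spec p (colourAt q) (trans (cong (λ V → lookup V (colourAt q)) same) (colourAt-at-y q))

    at-least : r + 1 ≤ length distinct
    at-least = avoiding-triples-bound r (paletteIndex y) code code-inj other-palette

  -- Y is non-empty: a vertex of X has a neighbour, which lies in Y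
  some-Y : 0 < N → ∃ λ y → side y ≡ true
  some-Y pos = by-side (side v₀) refl
    where
    v₀ = F.fromℕ< pos
    by-side : ∀ b → side v₀ ≡ b → ∃ λ y → side y ≡ true
    by-side true s₀ = v₀ , s₀
    by-side false s₀ = nbr zero , X-to-Y v₀ (nbr zero) (nbr-adj zero) s₀
      where open Enumerate v₀ (degX v₀ s₀)

  at-least-r+1 : 0 < N → r + 1 ≤ numPalettes φ
  at-least-r+1 pos = AroundY.at-least (proj₁ (some-Y pos)) (proj₂ (some-Y pos))

Biregular-cong : ∀ {a a' b b' G} → a ≡ a' → b ≡ b' → Biregular a b G → Biregular a' b' G
Biregular-cong refl refl bireg = bireg

3r∸3 : ∀ k → 3 * suc k ∸ 3 ≡ 3 * k
3r∸3 k = trans (cong (_∸ 3) (ℕP.*-suc 3 k)) (ℕP.m+n∸m≡n 3 (3 * k))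

proposition4p7 : (r : ℕ) → 2 ≤ r → (G : Graph) → 0 < n G →
    (Biregular 3 (3 * r) G → PaletteIndex≥ G (r + 1) × PaletteIndex≤ G (r * r + 1))
    × (Biregular (3 * r ∸ 3) (3 * r) G → PaletteIndex≤ G (r * r + 1))
proposition4p7 (suc (suc k)) (s≤s (s≤s z≤n)) G pos = part-i , part-ii
  where
  r = suc (suc k)
  part-i : Biregular 3 (3 * r) G → PaletteIndex≥ G (r + 1) × PaletteIndex≤ G (r * r + 1)
  part-i bireg = (λ M φ φ-proper → LowerBound.at-least-r+1 G k bireg φ φ-proper pos)
               , UpperBounds.one-triple (suc k) bireg
  part-ii : Biregular (3 * r ∸ 3) (3 * r) G → PaletteIndex≤ G (r * r + 1)
  part-ii bireg = subst (λ r → PaletteIndex≤ G (r * r + 1)) r-1+1≡r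
    (UpperBounds.one-dummy k (Biregular-cong {G = G} (3r∸3 (suc k)) (cong (λ r → 3 * r) (sym r-1+1≡r)) bireg))
    where
    r-1+1≡r : suc (k + 1) ≡ r
    r-1+1≡r = cong suc (ℕP.+-comm k 1)
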